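{- Let $R$ be a unital commutative ring, $\mathcal{R}$ a finitely generated $R$-algebra with generating set $\{t_1,\dots,t_l\}$, $T=\{r_0+\sum_i r_it_i : r_i\in R\}$, $n\ge2$, $I=\{0,\dots,n\}$ and $K_{\{i\}}=\langle e_{j,j+1}(m): j\in I\setminus\{i\}, m\in T\rangle\le\operatorname{EL}_{n+1}(\mathcal{R})$ (indices mod $n+1$). Let $\rho_{cyc}(i)=i+1 \bmod (n+1)$ and $\rho_{rev}(i)=n-i \bmod (n+1)$, let $\gamma_r=\gamma_{\rho_{cyc}}$ and $\gamma_s=\iota\circ\gamma_{\rho_{rev}}$, and let $\Gamma\le\operatorname{Aut}(\operatorname{EL}_{n+1}(\mathcal{R}))$ be the subgroup generated by $\gamma_r,\gamma_s$. Then $\Gamma$ preserves the subgroup geometry system $(K_{\{i\}})_{i\in I}$, and $\Psi(\Gamma)=D_{n+1}$.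
   Context: $e_{i,j}(r)$ is the elementary matrix (rows/columns indexed $0,\dots,n$) with $1$'s on the diagonal, $r$ at $(i,j)$, $0$ elsewhere; $\operatorname{EL}_{n+1}(\mathcal{R})$ is generated by them. For a permutation $\rho$ of $\{0,\dots,n\}$, $\gamma_\rho$ is the automorphism $(\gamma_\rho(A))(i,j)=A(\rho^{ -1}(i),\rho^{ -1}(j))$ (conjugation by a permutation matrix); $\iota(A)=(A^{ -1})^t$. An automorphism $\gamma$ preserves the subgroup geometry system if $\{\gamma(K_{\{i\}}): i\in I\}=\{K_{\{i\}} : i\in I\}$; a group of automorphisms preserves it if each element does. For such $\gamma$, $\psi_\gamma$ is the permutation of $\{0,\dots,n\}$ with $\gamma(K_{\{i\}})=K_{\{\psi_\gamma(i)\}}$, and $\Psi(\gamma)=\psi_\gamma$. $D_{n+1}$ is the dihedral group, realized as the set of permutations $\rho$ of $\{0,\dots,n\}$ such that $(i-j)\bmod(n+1)=\pm1$ iff $(\rho(i)-\rho(j))\bmod(n+1)=\pm1$. -}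

module Defs where

open import Level using (Level; _⊔_)
open import Algebra.Bundles using (Ring; CommutativeRing)
open import Algebra.Morphism.Structures using (module RingMorphisms)
open import Data.Nat using (ℕ; zero; suc; _∸_)
open import Data.Nat.DivMod using (_mod_)
open import Data.Fin using (Fin; toℕ)
import Data.Fin
import Relation.Nullary
open import Data.Integer using (ℤ; +_; _-_; _%ℕ_)
open import Data.Product using (Σ; _×_; _,_; ∃)
open import Data.Sum using (_⊎_)
open import Data.List using (List; []; _∷_)
open import Relation.Binary.PropositionalEquality using (_≡_; _≢_)
open import Relation.Nullary using (¬_)
open import Function.Definitions using (Bijective)

ρcyc : {n : ℕ} → Fin (suc n) → Fin (suc n)
ρcyc {n} i = (suc (toℕ i)) mod (suc n)

ρrev : {n : ℕ} → Fin (suc n) → Fin (suc n)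
ρrev {n} i = (n ∸ toℕ i) mod (suc n)

-- (i - j) mod (n+1) = ±1   (note -1 ≡ n mod (n+1))
Adj : {n : ℕ} → Fin (suc n) → Fin (suc n) → Set
Adj {n} i j = (((+ toℕ i) - (+ toℕ j)) %ℕ suc n ≡ 1)
            ⊎ (((+ toℕ i) - (+ toℕ j)) %ℕ suc n ≡ n)

-- The dihedral group D_{n+1}: permutations ρ of {0,…,n} with
-- (i-j) mod (n+1) = ±1  iff  (ρ i - ρ j) mod (n+1) = ±1
InDihedral : {n : ℕ} → (Fin (suc n) → Fin (suc n)) → Set
InDihedral {n} ρ =
  Bijective _≡_ _≡_ ρ ×
  (∀ i j → (Adj i j → Adj (ρ i) (ρ j)) × (Adj (ρ i) (ρ j) → Adj i j))

record IsAlgebraMap {a b c ℓ} (R : CommutativeRing a b) (ℛ : Ring c ℓ)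
         (φ : CommutativeRing.Carrier R → Ring.Carrier ℛ) : Set (a ⊔ b ⊔ c ⊔ ℓ) where
  open RingMorphisms (CommutativeRing.rawRing R) (Ring.rawRing ℛ)
  field
    isRingHom : IsRingHomomorphism φ
    central   : ∀ r x → Ring._≈_ ℛ (Ring._*_ ℛ (φ r) x) (Ring._*_ ℛ x (φ r))

module AlgebraDefs {a b c ℓ} (R : CommutativeRing a b) (ℛ : Ring c ℓ)
         (φ : CommutativeRing.Carrier R → Ring.Carrier ℛ) where
  open Ring ℛ

  data InSubalgebra {l : ℕ} (t : Fin l → Carrier) : Carrier → Set (a ⊔ c ⊔ ℓ) where
    scalar : ∀ r → InSubalgebra t (φ r)
    gen    : ∀ k → InSubalgebra t (t k)
    add    : ∀ {x y} → InSubalgebra t x → InSubalgebra t y → InSubalgebra t (x + y)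
    mul    : ∀ {x y} → InSubalgebra t x → InSubalgebra t y → InSubalgebra t (x * y)
    resp   : ∀ {x y} → InSubalgebra t x → x ≈ y → InSubalgebra t y

  Generates : {l : ℕ} → (Fin l → Carrier) → Set (a ⊔ c ⊔ ℓ)
  Generates t = ∀ x → InSubalgebra t x

  Σℛ : {m : ℕ} → (Fin m → Carrier) → Carrier
  Σℛ {zero}  f = 0#
  Σℛ {suc m} f = f Fin.zero + Σℛ (λ k → f (Fin.suc k))

  InT : {l : ℕ} → (Fin l → Carrier) → Carrier → Set (a ⊔ ℓ)
  InT {l} t m = Σ (CommutativeRing.Carrier R) λ r₀ →
                Σ (Fin l → CommutativeRing.Carrier R) λ r →
                m ≈ (φ r₀ + Σℛ (λ k → φ (r k) * t k))

module Matrices {c ℓ} (ℛ : Ring c ℓ) (n : ℕ) where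
  open Ring ℛ

  I : Set
  I = Fin (suc n)

  Mat : Set c
  Mat = I → I → Carrier

  _≋_ : Mat → Mat → Set ℓ
  A ≋ B = ∀ i j → A i j ≈ B i j

  sumI : {m : ℕ} → (Fin m → Carrier) → Carrier
  sumI {zero}  f = 0#
  sumI {suc m} f = f Fin.zero + sumI (λ k → f (Fin.suc k))

  _⊗_ : Mat → Mat → Mat
  (A ⊗ B) i j = sumI (λ k → A i k * B k j)

  δ : I → I → Carrier
  δ i j with i Data.Fin.≟ j
  ... | Relation.Nullary.yes _ = 1#
  ... | Relation.Nullary.no  _ = 0#

  𝟙 : Mat
  𝟙 = δ

  transpose : Mat → Mat
  transpose A i j = A j i

  -- elementary matrix e_{i,j}(r) (used for i ≠ j): 1 on the diagonal, r at (i,j), 0 elsewhere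
  e : I → I → Carrier → Mat
  e i j r k l with k Data.Fin.≟ l
  ... | Relation.Nullary.yes _ = 1#
  ... | Relation.Nullary.no  _ with k Data.Fin.≟ i | l Data.Fin.≟ j
  ...   | Relation.Nullary.yes _ | Relation.Nullary.yes _ = r
  ...   | _ | _ = 0#

  Pred : (p : Level) → Set (c Level.⊔ Level.suc p)
  Pred p = Mat → Set p

  data ⟨_⟩ {p} (S : Pred p) : Mat → Set (c ⊔ ℓ ⊔ p) where
    gen  : ∀ {A} → S A → ⟨ S ⟩ A
    one  : ⟨ S ⟩ 𝟙
    mul  : ∀ {A B} → ⟨ S ⟩ A → ⟨ S ⟩ B → ⟨ S ⟩ (A ⊗ B)
    inv  : ∀ {A B} → ⟨ S ⟩ A → (A ⊗ B) ≋ 𝟙 → (B ⊗ A) ≋ 𝟙 → ⟨ S ⟩ B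
    resp : ∀ {A B} → ⟨ S ⟩ A → A ≋ B → ⟨ S ⟩ B

  EL : Mat → Set (c ⊔ ℓ)
  EL = ⟨ (λ A → Σ I λ i → Σ I λ j → Σ Carrier λ r → i ≢ j × A ≋ e i j r) ⟩

  K : ∀ {q} → (Carrier → Set q) → I → Mat → Set (c ⊔ ℓ ⊔ q)
  K T i = ⟨ (λ A → Σ I λ j → Σ Carrier λ m → j ≢ i × T m × A ≋ e j (ρcyc j) m) ⟩

  -- Automorphisms, represented by their graphs  (γ A = B)

  -- γ_ρ(A)(i,j) = A(ρ⁻¹ i, ρ⁻¹ j), i.e. γ_ρ(A)(ρ i, ρ j) = A(i,j)
  Graphγ : (I → I) → Mat → Mat → Set ℓ
  Graphγ ρ A B = ∀ i j → B (ρ i) (ρ j) ≈ A i j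

  -- ι(A) = (A⁻¹)ᵗ, i.e. Bᵗ is the two-sided inverse of A
  Graphι : Mat → Mat → Set ℓ
  Graphι A B = (A ⊗ transpose B) ≋ 𝟙 × (transpose B ⊗ A) ≋ 𝟙

  Graphr : Mat → Mat → Set ℓ
  Graphr = Graphγ ρcyc

  Graphs : Mat → Mat → Set (c ⊔ ℓ)
  Graphs A B = Σ Mat λ C → Graphγ ρrev A C × Graphι C B

  data Letter : Set where
    r r⁻¹ s s⁻¹ : Letter

  GraphL : Letter → Mat → Mat → Set (c ⊔ ℓ)
  GraphL r   A B = Level.Lift c (Graphr A B)
  GraphL r⁻¹ A B = Level.Lift c (Graphr B A)
  GraphL s   A B = Graphs A B
  GraphL s⁻¹ A B = Graphs B A

  -- Elements of Γ = ⟨γ_r, γ_s⟩ are words in the generators and their inverses;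
  -- the word g₁ ∷ … ∷ g_k ∷ [] denotes γ_{g₁} ∘ … ∘ γ_{g_k}.
  Γ : Set
  Γ = List Letter

  Graph : Γ → Mat → Mat → Set (c ⊔ ℓ)
  Graph []      A B = Level.Lift c (A ≋ B)
  Graph (g ∷ w) A B = Σ Mat λ C → Graph w A C × GraphL g C B

  image : ∀ {p} → Γ → Pred p → Pred (c ⊔ ℓ ⊔ p)
  image w P B = Σ Mat λ A → P A × Graph w A B

  _≐_ : ∀ {p q} → Pred p → Pred q → Set (c ⊔ p ⊔ q)
  P ≐ Q = ∀ A → (P A → Q A) × (Q A → P A)

-- The rotation γ_r is conjugation by the cyclic shift ρcyc, which permutes the generators e_{j,j+1}(m)
-- of the K_{i} and so carries K_{i} onto K_{ρcyc i}. For γ_s = ι ∘ γ_{ρrev} no generator-by-generator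
-- argument is available, because over a non-commutative ring transposition does not reverse products.
-- Instead K_{n} is described intrinsically: it consists of the unitriangular matrices whose entry at
-- distance k from the diagonal is some x with every e_{a,a+k}(x) in K_{n} (commutators give the products
-- needed for the entries above distance 1). This description depends only on distances, so it is invariant
-- under the anti-transpose θ, and γ_s(A) = θ(A)⁻¹; rotating then gives γ_s(K_{i}) = K_{ψₛ i}.
-- Hence every element of Γ acts on indices by a word in ρcyc^{±1} and ψₛ, which lies in D_{n+1}.
-- Conversely, a permutation preserving cyclic adjacency is fixed by the image of 0 and whether it keeps or
-- reverses the orientation there, so it is ρcyc^m or ψₛ ∘ ρcyc^m, the action of r^m or s r^m.
module Submission where

open import Defs
open import Level using (_⊔_)
open import Algebra.Bundles using (Ring; CommutativeRing)
open import Data.Nat using (ℕ; zero; suc; _≤_; z≤n; s≤s)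
open import Data.Fin using (Fin; toℕ)
open import Data.Product using (Σ; _×_; _,_; proj₁; proj₂)
open import Data.Sum using (_⊎_; inj₁; inj₂)
open import Data.Empty using (⊥-elim)
open import Function using (_∘_)
open import Data.Nat.Properties using (<⇒≤)
open import Relation.Nullary using (¬_; yes; no; Dec)
import Relation.Binary.PropositionalEquality as ≡
open ≡ using (_≡_; _≢_)

module CyclicIndex (n : ℕ) where
  open ≡
  open import Data.Nat using (_+_; _∸_; _<_; _%_)
  open import Data.Nat.Properties
  open import Data.Nat.DivMod
    using (_mod_; m≤n⇒m%n≡m; %-distribˡ-+; m%n%n≡m%n; [m+n]%n≡m%n; n%n≡0)
  open import Data.Fin using (fromℕ)
  open import Data.Fin.Properties using (toℕ-fromℕ<; toℕ-injective; toℕ≤pred[n]; toℕ-fromℕ)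
  open import Data.Fin.Permutation using (Permutation′; permutation)

  I : Set
  I = Fin (suc n)

  ⟦_⟧ : ℕ → I
  ⟦ m ⟧ = m mod suc n

  last : I
  last = fromℕ n

  ρcyc⁻¹ : I → I
  ρcyc⁻¹ i = ⟦ n + toℕ i ⟧

  -- γ_s = ι ∘ γ_{ρrev} sends e_{j,j+1}(m) to e_{ψₛ j, ψₛ j + 1}(-m).
  ψₛ : I → I
  ψₛ i = ρcyc⁻¹ (ρrev i)

  ρcyc^ : ℕ → I → I
  ρcyc^ zero    i = i
  ρcyc^ (suc k) i = ρcyc (ρcyc^ k i)

  toℕ≤n : (i : I) → toℕ i ≤ n
  toℕ≤n = toℕ≤pred[n]

  toℕ-⟦⟧ : ∀ m → toℕ ⟦ m ⟧ ≡ m % suc n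
  toℕ-⟦⟧ m = toℕ-fromℕ< _

  toℕ-⟦⟧-≤ : ∀ {m} → m ≤ n → toℕ ⟦ m ⟧ ≡ m
  toℕ-⟦⟧-≤ {m} m≤n = trans (toℕ-⟦⟧ m) (m≤n⇒m%n≡m m≤n)

  ⟦toℕ⟧ : ∀ i → ⟦ toℕ i ⟧ ≡ i
  ⟦toℕ⟧ i = toℕ-injective (toℕ-⟦⟧-≤ (toℕ≤n i))

  ⟦⟧-cong-% : ∀ m m′ → m % suc n ≡ m′ % suc n → ⟦ m ⟧ ≡ ⟦ m′ ⟧
  ⟦⟧-cong-% m m′ eq = toℕ-injective (trans (toℕ-⟦⟧ m) (trans eq (sym (toℕ-⟦⟧ m′))))

  ⟦+⟦⟧⟧ : ∀ k m → ⟦ k + toℕ ⟦ m ⟧ ⟧ ≡ ⟦ k + m ⟧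
  ⟦+⟦⟧⟧ k m = ⟦⟧-cong-% (k + toℕ ⟦ m ⟧) (k + m) (begin
      (k + toℕ ⟦ m ⟧) % suc n                        ≡⟨ cong (λ x → (k + x) % suc n) (toℕ-⟦⟧ m) ⟩
      (k + m % suc n) % suc n                        ≡⟨ %-distribˡ-+ k (m % suc n) (suc n) ⟩
      (k % suc n + m % suc n % suc n) % suc n        ≡⟨ cong (λ x → (k % suc n + x) % suc n) (m%n%n≡m%n m (suc n)) ⟩
      (k % suc n + m % suc n) % suc n                ≡⟨ %-distribˡ-+ k m (suc n) ⟨
      (k + m) % suc n                                ∎)
    where open ≡-Reasoning

  ⟦1+n+⟧ : ∀ m → ⟦ suc n + m ⟧ ≡ ⟦ m ⟧
  ⟦1+n+⟧ m = ⟦⟧-cong-% (suc n + m) m (trans (cong (_% suc n) (+-comm (suc n) m)) ([m+n]%n≡m%n m (suc n)))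

  ρcyc-ρcyc⁻¹ : ∀ i → ρcyc (ρcyc⁻¹ i) ≡ i
  ρcyc-ρcyc⁻¹ i = trans (⟦+⟦⟧⟧ 1 (n + toℕ i)) (trans (⟦1+n+⟧ (toℕ i)) (⟦toℕ⟧ i))

  ρcyc⁻¹-ρcyc : ∀ i → ρcyc⁻¹ (ρcyc i) ≡ i
  ρcyc⁻¹-ρcyc i = begin
    ⟦ n + toℕ ⟦ suc (toℕ i) ⟧ ⟧ ≡⟨ ⟦+⟦⟧⟧ n (suc (toℕ i)) ⟩
    ⟦ n + suc (toℕ i) ⟧         ≡⟨ cong ⟦_⟧ (+-suc n (toℕ i)) ⟩
    ⟦ suc n + toℕ i ⟧           ≡⟨ ⟦1+n+⟧ (toℕ i) ⟩
    ⟦ toℕ i ⟧                   ≡⟨ ⟦toℕ⟧ i ⟩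
    i                           ∎
    where open ≡-Reasoning

  ρcyc-injective : ∀ {i j} → ρcyc i ≡ ρcyc j → i ≡ j
  ρcyc-injective {i} {j} eq = trans (sym (ρcyc⁻¹-ρcyc i)) (trans (cong ρcyc⁻¹ eq) (ρcyc⁻¹-ρcyc j))

  ρcyc⁻¹-injective : ∀ {i j} → ρcyc⁻¹ i ≡ ρcyc⁻¹ j → i ≡ j
  ρcyc⁻¹-injective {i} {j} eq = trans (sym (ρcyc-ρcyc⁻¹ i)) (trans (cong ρcyc eq) (ρcyc-ρcyc⁻¹ j))

  ρcyc⁻¹-ρcyc-comm : ∀ i → ρcyc⁻¹ (ρcyc i) ≡ ρcyc (ρcyc⁻¹ i)
  ρcyc⁻¹-ρcyc-comm i = trans (ρcyc⁻¹-ρcyc i) (sym (ρcyc-ρcyc⁻¹ i))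

  toℕ-last : toℕ last ≡ n
  toℕ-last = toℕ-fromℕ n

  toℕ-ρcyc-< : ∀ i → toℕ i < n → toℕ (ρcyc i) ≡ suc (toℕ i)
  toℕ-ρcyc-< i = toℕ-⟦⟧-≤

  toℕ-ρcyc-≡n : ∀ i → toℕ i ≡ n → toℕ (ρcyc i) ≡ 0
  toℕ-ρcyc-≡n i eq = trans (toℕ-⟦⟧ (suc (toℕ i))) (trans (cong (λ x → suc x % suc n) eq) (n%n≡0 (suc n)))

  ρcyc-last : ρcyc last ≡ Fin.zero
  ρcyc-last = toℕ-injective (toℕ-ρcyc-≡n last toℕ-last)

  ≢last⇒< : ∀ {i} → i ≢ last → toℕ i < n
  ≢last⇒< {i} i≢last with m≤n⇒m<n∨m≡n (toℕ≤n i)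
  ... | inj₁ lt = lt
  ... | inj₂ eq = ⊥-elim (i≢last (toℕ-injective (trans eq (sym toℕ-last))))

  ρcyc-of-suc : ∀ {a b : I} → toℕ b ≡ suc (toℕ a) → b ≡ ρcyc a
  ρcyc-of-suc {a} {b} eq = toℕ-injective (trans eq (sym (toℕ-ρcyc-< a (subst (_≤ n) eq (toℕ≤n b)))))

  suc-≢last : ∀ {a b : I} → toℕ b ≡ suc (toℕ a) → a ≢ last
  suc-≢last {a} {b} eq refl = 1+n≰n (subst (_≤ n) (trans eq (cong suc toℕ-last)) (toℕ≤n b))

  ρcyc-≢ : 1 ≤ n → ∀ i → ρcyc i ≢ i
  ρcyc-≢ 1≤n i eq with m≤n⇒m<n∨m≡n (toℕ≤n i)
  ... | inj₁ lt = 1+n≢n (trans (sym (toℕ-ρcyc-< i lt)) (cong toℕ eq))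
  ... | inj₂ i≡n = 1+n≰n {0} (subst (1 ≤_) (trans (sym i≡n) (trans (cong toℕ (sym eq)) (toℕ-ρcyc-≡n i i≡n))) 1≤n)

  ρcyc²-≢ : 2 ≤ n → ∀ i → ρcyc (ρcyc i) ≢ i
  ρcyc²-≢ 2≤n i eq with m≤n⇒m<n∨m≡n (toℕ≤n i)
  ... | inj₂ i≡n = <⇒≢ 2≤n (trans (sym i≡1) i≡n)
    where
      ρcyc-i≡0 = toℕ-ρcyc-≡n i i≡n
      i≡1 : toℕ i ≡ 1
      i≡1 = trans (cong toℕ (sym eq))
              (trans (toℕ-ρcyc-< (ρcyc i) (subst (_< n) (sym ρcyc-i≡0) (<-trans (s≤s z≤n) 2≤n)))
                     (cong suc ρcyc-i≡0))
  ... | inj₁ i<n with m≤n⇒m<n∨m≡n (toℕ≤n (ρcyc i))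
  ...   | inj₁ ρi<n = <-irrefl (cong toℕ (sym eq)) (begin-strict
      toℕ i                  <⟨ m<n+m (toℕ i) (s≤s z≤n) ⟩
      2 + toℕ i              ≡⟨ cong suc (toℕ-ρcyc-< i i<n) ⟨
      suc (toℕ (ρcyc i))     ≡⟨ toℕ-ρcyc-< (ρcyc i) ρi<n ⟨
      toℕ (ρcyc (ρcyc i))    ∎)
    where open ≤-Reasoning
  ...   | inj₂ ρi≡n = <⇒≢ 2≤n (sym (trans (sym ρi≡n) (trans (toℕ-ρcyc-< i i<n) (cong suc i≡0))))
    where
      i≡0 : toℕ i ≡ 0
      i≡0 = trans (cong toℕ (sym eq)) (toℕ-ρcyc-≡n (ρcyc i) ρi≡n)

  toℕ-ρrev : ∀ i → toℕ (ρrev i) ≡ n ∸ toℕ i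
  toℕ-ρrev i = toℕ-⟦⟧-≤ (m∸n≤m n (toℕ i))

  ρrev-involutive : ∀ i → ρrev (ρrev i) ≡ i
  ρrev-involutive i = trans (cong (λ x → ⟦ n ∸ x ⟧) (toℕ-ρrev i))
                        (trans (cong ⟦_⟧ (m∸[m∸n]≡n (toℕ≤n i))) (⟦toℕ⟧ i))

  ρrev-ρcyc : ∀ i → ρrev (ρcyc i) ≡ ρcyc⁻¹ (ρrev i)
  ρrev-ρcyc i with m≤n⇒m<n∨m≡n (toℕ≤n i)
  ... | inj₁ lt = begin
    ⟦ n ∸ toℕ (ρcyc i) ⟧         ≡⟨ cong (λ x → ⟦ n ∸ x ⟧) (toℕ-ρcyc-< i lt) ⟩
    ⟦ n ∸ suc (toℕ i) ⟧          ≡⟨ ⟦1+n+⟧ (n ∸ suc (toℕ i)) ⟨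
    ⟦ suc n + (n ∸ suc (toℕ i)) ⟧ ≡⟨ cong ⟦_⟧ (+-suc n (n ∸ suc (toℕ i))) ⟨
    ⟦ n + suc (n ∸ suc (toℕ i)) ⟧ ≡⟨ cong (λ x → ⟦ n + x ⟧) (+-∸-assoc 1 lt) ⟨
    ⟦ n + (n ∸ toℕ i) ⟧          ≡⟨ cong (λ x → ⟦ n + x ⟧) (toℕ-ρrev i) ⟨
    ρcyc⁻¹ (ρrev i)              ∎
    where open ≡-Reasoning
  ... | inj₂ i≡n = begin
    ⟦ n ∸ toℕ (ρcyc i) ⟧         ≡⟨ cong (λ x → ⟦ n ∸ x ⟧) (toℕ-ρcyc-≡n i i≡n) ⟩
    ⟦ n ⟧                        ≡⟨ cong ⟦_⟧ (+-identityʳ n) ⟨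
    ⟦ n + 0 ⟧                    ≡⟨ cong (λ x → ⟦ n + x ⟧) (trans (cong (n ∸_) i≡n) (n∸n≡0 n)) ⟨
    ⟦ n + (n ∸ toℕ i) ⟧          ≡⟨ cong (λ x → ⟦ n + x ⟧) (toℕ-ρrev i) ⟨
    ρcyc⁻¹ (ρrev i)              ∎
    where open ≡-Reasoning

  ρrev-ρcyc⁻¹ : ∀ i → ρrev (ρcyc⁻¹ i) ≡ ρcyc (ρrev i)
  ρrev-ρcyc⁻¹ i = ρcyc⁻¹-injective (begin
    ρcyc⁻¹ (ρrev (ρcyc⁻¹ i))               ≡⟨ ρrev-ρcyc (ρcyc⁻¹ i) ⟨
    ρrev (ρcyc (ρcyc⁻¹ i))                 ≡⟨ cong ρrev (ρcyc-ρcyc⁻¹ i) ⟩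
    ρrev i                                 ≡⟨ ρcyc⁻¹-ρcyc (ρrev i) ⟨
    ρcyc⁻¹ (ρcyc (ρrev i))                 ∎)
    where open ≡-Reasoning

  ψₛ-ρcyc : ∀ i → ψₛ (ρcyc i) ≡ ρcyc⁻¹ (ψₛ i)
  ψₛ-ρcyc i = cong ρcyc⁻¹ (ρrev-ρcyc i)

  ψₛ-involutive : ∀ i → ψₛ (ψₛ i) ≡ i
  ψₛ-involutive i = trans (cong ρcyc⁻¹ (ρrev-ρcyc⁻¹ (ρrev i)))
                      (trans (ρcyc⁻¹-ρcyc (ρrev (ρrev i))) (ρrev-involutive i))

  ψₛ-last : ψₛ last ≡ last
  ψₛ-last = toℕ-injective (begin
    toℕ ⟦ n + toℕ (ρrev last) ⟧   ≡⟨ cong (λ x → toℕ ⟦ n + x ⟧) ρrev-last ⟩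
    toℕ ⟦ n + 0 ⟧                 ≡⟨ cong (toℕ ∘ ⟦_⟧) (+-identityʳ n) ⟩
    toℕ ⟦ n ⟧                     ≡⟨ toℕ-⟦⟧-≤ ≤-refl ⟩
    n                             ≡⟨ toℕ-last ⟨
    toℕ last                      ∎)
    where
      open ≡-Reasoning
      ρrev-last : toℕ (ρrev last) ≡ 0
      ρrev-last = trans (toℕ-ρrev last) (trans (cong (n ∸_) toℕ-last) (n∸n≡0 n))

  toℕ-ρcyc^-zero : ∀ k → k ≤ n → toℕ (ρcyc^ k Fin.zero) ≡ k
  toℕ-ρcyc^-zero zero    _   = refl
  toℕ-ρcyc^-zero (suc k) k<n =
    trans (toℕ-ρcyc-< _ (subst (_< n) (sym ih) k<n)) (cong suc ih)
    where ih = toℕ-ρcyc^-zero k (<⇒≤ k<n)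

  ρcyc^-zero : ∀ i → ρcyc^ (toℕ i) Fin.zero ≡ i
  ρcyc^-zero i = toℕ-injective (toℕ-ρcyc^-zero (toℕ i) (toℕ≤n i))

  ρcyc-perm : Permutation′ (suc n)
  ρcyc-perm = permutation ρcyc ρcyc⁻¹ ρcyc-ρcyc⁻¹ ρcyc⁻¹-ρcyc

  ρcyc⁻¹-perm : Permutation′ (suc n)
  ρcyc⁻¹-perm = permutation ρcyc⁻¹ ρcyc ρcyc⁻¹-ρcyc ρcyc-ρcyc⁻¹

  ρrev-perm : Permutation′ (suc n)
  ρrev-perm = permutation ρrev ρrev ρrev-involutive ρrev-involutive

module Dihedral (n : ℕ) where
  open ≡
  open CyclicIndex n
  open import Data.Nat using (_+_; _∸_; _<_)
  open import Data.Nat.Properties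
  open import Data.Nat.DivMod using (m≤n⇒m%n≡m)
  open import Data.Integer as ℤ using (_%ℕ_)
  import Data.Integer.Properties as ℤ
  open import Data.Fin.Properties using (toℕ-injective)
  open import Function.Definitions using (Injective)

  Neighbours : I → I → Set
  Neighbours i j = i ≡ ρcyc j ⊎ j ≡ ρcyc i

  PreservesNeighbours : (I → I) → Set
  PreservesNeighbours f = ∀ {i j} → Neighbours i j → Neighbours (f i) (f j)

  diff : ℕ → ℕ → ℕ
  diff a b = ((ℤ.+ a) ℤ.- (ℤ.+ b)) %ℕ suc n

  diff-≥ : ∀ {a b} → b ≤ a → a ≤ n → diff a b ≡ a ∸ b
  diff-≥ {a} {b} b≤a a≤n rewrite ℤ.m-n≡m⊖n a b | ℤ.⊖-≥ b≤a = m≤n⇒m%n≡m (≤-trans (m∸n≤m a b) a≤n)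

  diff-< : ∀ {a b} → a < b → b ≤ n → diff a b ≡ suc n ∸ (b ∸ a)
  diff-< {a} {b} a<b b≤n rewrite ℤ.m-n≡m⊖n a b | ℤ.⊖-< a<b with b ∸ a | m∸n≤m b a | m<n⇒0<n∸m a<b
  ... | suc d | d<b | _ rewrite m≤n⇒m%n≡m (≤-trans d<b b≤n) = refl

  ∸≡⇒≡+ : ∀ {m k d} → k ≤ m → m ∸ k ≡ d → m ≡ d + k
  ∸≡⇒≡+ {m} {k} k≤m eq = trans (sym (m∸n+n≡m k≤m)) (cong (_+ k) eq)

  +≤⇒≡0 : ∀ {m k} → m + k ≤ m → k ≡ 0
  +≤⇒≡0 {m} {k} le = n≤0⇒n≡0 (+-cancelˡ-≤ m k 0 (subst (m + k ≤_) (sym (+-identityʳ m)) le))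

  ρcyc-cases : ∀ i → (toℕ i < n × toℕ (ρcyc i) ≡ suc (toℕ i)) ⊎ (toℕ i ≡ n × toℕ (ρcyc i) ≡ 0)
  ρcyc-cases i with m≤n⇒m<n∨m≡n (toℕ≤n i)
  ... | inj₁ i<n = inj₁ (i<n , toℕ-ρcyc-< i i<n)
  ... | inj₂ i≡n = inj₂ (i≡n , toℕ-ρcyc-≡n i i≡n)

  diff-ρcyc-≡1 : 1 ≤ n → ∀ j → diff (toℕ (ρcyc j)) (toℕ j) ≡ 1
  diff-ρcyc-≡1 1≤n j with ρcyc-cases j
  ... | inj₁ (j<n , eq) rewrite eq = trans (diff-≥ (n≤1+n _) j<n) (m+n∸n≡m 1 (toℕ j))
  ... | inj₂ (j≡n , eq) rewrite eq | j≡n = trans (diff-< 1≤n ≤-refl) (m+n∸n≡m 1 n)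

  diff-ρcyc-≡n : ∀ i → diff (toℕ i) (toℕ (ρcyc i)) ≡ n
  diff-ρcyc-≡n i with ρcyc-cases i
  ... | inj₁ (i<n , eq) rewrite eq = trans (diff-< (n<1+n _) i<n) (cong (suc n ∸_) (m+n∸n≡m 1 (toℕ i)))
  ... | inj₂ (i≡n , eq) rewrite eq | i≡n = diff-≥ z≤n ≤-refl

  diff≡1⇒ρcyc : ∀ i j → diff (toℕ i) (toℕ j) ≡ 1 → i ≡ ρcyc j
  diff≡1⇒ρcyc i j d≡1 with ≤-<-connex (toℕ j) (toℕ i)
  ... | inj₁ j≤i = ρcyc-of-suc (∸≡⇒≡+ j≤i (trans (sym (diff-≥ j≤i (toℕ≤n i))) d≡1))
  ... | inj₂ i<j = toℕ-injective (trans i≡0 (sym (toℕ-ρcyc-≡n j j≡n)))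
    where
      gap≡n : toℕ j ∸ toℕ i ≡ n
      gap≡n = suc-injective (sym (∸≡⇒≡+ (≤-trans (m∸n≤m (toℕ j) (toℕ i)) (m≤n⇒m≤1+n (toℕ≤n j)))
                                        (trans (sym (diff-< i<j (toℕ≤n j))) d≡1)))
      j≡n+i : toℕ j ≡ n + toℕ i
      j≡n+i = ∸≡⇒≡+ (<⇒≤ i<j) gap≡n
      i≡0 : toℕ i ≡ 0
      i≡0 = +≤⇒≡0 (subst (_≤ n) j≡n+i (toℕ≤n j))
      j≡n : toℕ j ≡ n
      j≡n = trans j≡n+i (trans (cong (n +_) i≡0) (+-identityʳ n))

  diff≡n⇒ρcyc : ∀ i j → diff (toℕ i) (toℕ j) ≡ n → j ≡ ρcyc i
  diff≡n⇒ρcyc i j d≡n with ≤-<-connex (toℕ j) (toℕ i)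
  ... | inj₁ j≤i = toℕ-injective (trans j≡0 (sym (toℕ-ρcyc-≡n i i≡n)))
    where
      i≡n+j : toℕ i ≡ n + toℕ j
      i≡n+j = ∸≡⇒≡+ j≤i (trans (sym (diff-≥ j≤i (toℕ≤n i))) d≡n)
      j≡0 : toℕ j ≡ 0
      j≡0 = +≤⇒≡0 (subst (_≤ n) i≡n+j (toℕ≤n i))
      i≡n : toℕ i ≡ n
      i≡n = trans i≡n+j (trans (cong (n +_) j≡0) (+-identityʳ n))
  ... | inj₂ i<j = ρcyc-of-suc (∸≡⇒≡+ (<⇒≤ i<j) gap≡1)
    where
      gap≡1 : toℕ j ∸ toℕ i ≡ 1
      gap≡1 = +-cancelˡ-≡ n _ _ (trans (sym (∸≡⇒≡+ (≤-trans (m∸n≤m (toℕ j) (toℕ i)) (m≤n⇒m≤1+n (toℕ≤n j)))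
                                                   (trans (sym (diff-< i<j (toℕ≤n j))) d≡n)))
                                         (+-comm 1 n))

  Adj⇒Neighbours : ∀ {i j} → Adj i j → Neighbours i j
  Adj⇒Neighbours {i} {j} (inj₁ d≡1) = inj₁ (diff≡1⇒ρcyc i j d≡1)
  Adj⇒Neighbours {i} {j} (inj₂ d≡n) = inj₂ (diff≡n⇒ρcyc i j d≡n)

  Neighbours⇒Adj : 1 ≤ n → ∀ {i j} → Neighbours i j → Adj i j
  Neighbours⇒Adj 1≤n {j = j} (inj₁ refl) = inj₁ (diff-ρcyc-≡1 1≤n j)
  Neighbours⇒Adj 1≤n {i}     (inj₂ refl) = inj₂ (diff-ρcyc-≡n i)

  commuting⇒PreservesNeighbours : ∀ {f : I → I} → (∀ i → f (ρcyc i) ≡ ρcyc (f i)) → PreservesNeighbours f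
  commuting⇒PreservesNeighbours {f} comm {j = j} (inj₁ refl) = inj₁ (comm j)
  commuting⇒PreservesNeighbours {f} comm {i}     (inj₂ refl) = inj₂ (comm i)

  anticommuting⇒PreservesNeighbours : ∀ {f : I → I} → (∀ i → f (ρcyc i) ≡ ρcyc⁻¹ (f i)) → PreservesNeighbours f
  anticommuting⇒PreservesNeighbours {f} anti {j = j} (inj₁ refl) =
    inj₂ (trans (sym (ρcyc-ρcyc⁻¹ (f j))) (cong ρcyc (sym (anti j))))
  anticommuting⇒PreservesNeighbours {f} anti {i}     (inj₂ refl) =
    inj₁ (trans (sym (ρcyc-ρcyc⁻¹ (f i))) (cong ρcyc (sym (anti i))))

  inverses⇒InDihedral : 1 ≤ n → ∀ f g → (∀ x → f (g x) ≡ x) → (∀ x → g (f x) ≡ x) →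
                        PreservesNeighbours f → PreservesNeighbours g → InDihedral f
  inverses⇒InDihedral 1≤n f g fg gf pf pg =
    ( (λ {x} {y} eq → trans (sym (gf x)) (trans (cong g eq) (gf y)))
    , (λ y → g y , λ { refl → fg y }) )
    , λ i j → ( Neighbours⇒Adj 1≤n ∘ pf ∘ Adj⇒Neighbours
              , λ adj → subst₂ Adj (gf i) (gf j) (Neighbours⇒Adj 1≤n (pg (Adj⇒Neighbours adj))) )

  InDihedral⇒PreservesNeighbours : 1 ≤ n → ∀ {ρ : I → I} → InDihedral ρ → PreservesNeighbours ρ
  InDihedral⇒PreservesNeighbours 1≤n {ρ} (_ , adj) {i} {j} =
    Adj⇒Neighbours ∘ proj₁ (adj i j) ∘ Neighbours⇒Adj 1≤n

  id-InDihedral : InDihedral {n} (λ i → i)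
  id-InDihedral = ((λ eq → eq) , (λ y → y , λ { refl → refl })) , (λ i j → (λ a → a) , (λ a → a))

  ∘-InDihedral : ∀ {f g : I → I} → InDihedral f → InDihedral g → InDihedral (f ∘ g)
  ∘-InDihedral {f} {g} ((f-inj , f-surj) , f-adj) ((g-inj , g-surj) , g-adj) =
    ((g-inj ∘ f-inj) , surj) ,
    λ i j → ( proj₁ (f-adj (g i) (g j)) ∘ proj₁ (g-adj i j)
            , proj₂ (g-adj i j) ∘ proj₂ (f-adj (g i) (g j)) )
    where
      surj : ∀ y → Σ I λ x → ∀ {z} → z ≡ x → f (g z) ≡ y
      surj y with f-surj y
      ... | x₁ , fx₁≡y with g-surj x₁
      ...   | x₂ , gx₂≡x₁ = x₂ , λ z≡x₂ → fx₁≡y (gx₂≡x₁ z≡x₂)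

  ρcyc-InDihedral : 1 ≤ n → InDihedral ρcyc
  ρcyc-InDihedral 1≤n = inverses⇒InDihedral 1≤n ρcyc ρcyc⁻¹ ρcyc-ρcyc⁻¹ ρcyc⁻¹-ρcyc
    (commuting⇒PreservesNeighbours (λ _ → refl)) (commuting⇒PreservesNeighbours ρcyc⁻¹-ρcyc-comm)

  ρcyc⁻¹-InDihedral : 1 ≤ n → InDihedral ρcyc⁻¹
  ρcyc⁻¹-InDihedral 1≤n = inverses⇒InDihedral 1≤n ρcyc⁻¹ ρcyc ρcyc⁻¹-ρcyc ρcyc-ρcyc⁻¹
    (commuting⇒PreservesNeighbours ρcyc⁻¹-ρcyc-comm) (commuting⇒PreservesNeighbours (λ _ → refl))

  ψₛ-InDihedral : 1 ≤ n → InDihedral ψₛ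
  ψₛ-InDihedral 1≤n = inverses⇒InDihedral 1≤n ψₛ ψₛ ψₛ-involutive ψₛ-involutive
    (anticommuting⇒PreservesNeighbours ψₛ-ρcyc) (anticommuting⇒PreservesNeighbours ψₛ-ρcyc)

  ρcyc^-ρcyc : ∀ k i → ρcyc^ k (ρcyc i) ≡ ρcyc (ρcyc^ k i)
  ρcyc^-ρcyc zero    i = refl
  ρcyc^-ρcyc (suc k) i = cong ρcyc (ρcyc^-ρcyc k i)

  commuting-ρcyc^ : ∀ {f : I → I} → (∀ i → f (ρcyc i) ≡ ρcyc (f i)) → ∀ k i → f (ρcyc^ k i) ≡ ρcyc^ k (f i)
  commuting-ρcyc^ comm zero    i = refl
  commuting-ρcyc^ {f} comm (suc k) i = trans (comm (ρcyc^ k i)) (cong ρcyc (commuting-ρcyc^ comm k i))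

  commuting⇒≡ρcyc^ : ∀ {f : I → I} → (∀ i → f (ρcyc i) ≡ ρcyc (f i)) → ∀ i → f i ≡ ρcyc^ (toℕ (f Fin.zero)) i
  commuting⇒≡ρcyc^ {f} comm i = begin
    f i                                  ≡⟨ cong f (ρcyc^-zero i) ⟨
    f (ρcyc^ (toℕ i) Fin.zero)           ≡⟨ commuting-ρcyc^ {f} comm (toℕ i) Fin.zero ⟩
    ρcyc^ (toℕ i) (f Fin.zero)           ≡⟨ cong (ρcyc^ (toℕ i)) (ρcyc^-zero (f Fin.zero)) ⟨
    ρcyc^ (toℕ i) (ρcyc^ m Fin.zero)     ≡⟨ commuting-ρcyc^ {ρcyc^ m} (ρcyc^-ρcyc m) (toℕ i) Fin.zero ⟨
    ρcyc^ m (ρcyc^ (toℕ i) Fin.zero)     ≡⟨ cong (ρcyc^ m) (ρcyc^-zero i) ⟩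
    ρcyc^ m i                            ∎
    where
      open ≡-Reasoning
      m = toℕ (f Fin.zero)

  -- The neighbours of ρcyc x are x and ρcyc² x, which 2 ≤ n keeps apart; so commuting with ρcyc at x
  -- leaves only one place for ρ (ρcyc² x).
  commuting-propagates : 2 ≤ n → ∀ {ρ : I → I} → Injective _≡_ _≡_ ρ → PreservesNeighbours ρ →
                         ρ (ρcyc Fin.zero) ≡ ρcyc (ρ Fin.zero) → ∀ i → ρ (ρcyc i) ≡ ρcyc (ρ i)
  commuting-propagates 2≤n {ρ} inj pres base i =
    subst (λ x → ρ (ρcyc x) ≡ ρcyc (ρ x)) (ρcyc^-zero i) (along (toℕ i))
    where
      step : ∀ x → ρ (ρcyc x) ≡ ρcyc (ρ x) → ρ (ρcyc (ρcyc x)) ≡ ρcyc (ρ (ρcyc x))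
      step x commutes-at-x with pres {ρcyc x} {ρcyc (ρcyc x)} (inj₂ refl)
      ... | inj₂ commutes = commutes
      ... | inj₁ flips = ⊥-elim (ρcyc²-≢ 2≤n x (sym (inj (ρcyc-injective (trans (sym commutes-at-x) flips)))))
      along : ∀ k → ρ (ρcyc (ρcyc^ k Fin.zero)) ≡ ρcyc (ρ (ρcyc^ k Fin.zero))
      along zero    = base
      along (suc k) = step (ρcyc^ k Fin.zero) (along k)

  rotation-of-dihedral : 2 ≤ n → ∀ {f : I → I} → InDihedral f → f (ρcyc Fin.zero) ≡ ρcyc (f Fin.zero) →
                         ∀ i → f i ≡ ρcyc^ (toℕ (f Fin.zero)) i
  rotation-of-dihedral 2≤n D base = commuting⇒≡ρcyc^
    (commuting-propagates 2≤n (proj₁ (proj₁ D)) (InDihedral⇒PreservesNeighbours (<⇒≤ 2≤n) D) base)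

  dihedral-classification : 2 ≤ n → ∀ ρ → InDihedral ρ →
    Σ ℕ λ m → (∀ i → ρ i ≡ ρcyc^ m i) ⊎ (∀ i → ρ i ≡ ψₛ (ρcyc^ m i))
  dihedral-classification 2≤n ρ D
    with InDihedral⇒PreservesNeighbours (<⇒≤ 2≤n) D {Fin.zero} {ρcyc Fin.zero} (inj₂ refl)
  ... | inj₂ commutes = toℕ (ρ Fin.zero) , inj₁ (rotation-of-dihedral 2≤n D commutes)
  ... | inj₁ flips = toℕ (ψₛ (ρ Fin.zero)) , inj₂ λ i →
          trans (sym (ψₛ-involutive (ρ i)))
                (cong ψₛ (rotation-of-dihedral 2≤n (∘-InDihedral (ψₛ-InDihedral (<⇒≤ 2≤n)) D) base i))
    where
      base : ψₛ (ρ (ρcyc Fin.zero)) ≡ ρcyc (ψₛ (ρ Fin.zero))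
      base = begin
        ψₛ (ρ (ρcyc Fin.zero))                  ≡⟨ ρcyc-ρcyc⁻¹ _ ⟨
        ρcyc (ρcyc⁻¹ (ψₛ (ρ (ρcyc Fin.zero))))  ≡⟨ cong ρcyc (ψₛ-ρcyc _) ⟨
        ρcyc (ψₛ (ρcyc (ρ (ρcyc Fin.zero))))    ≡⟨ cong (ρcyc ∘ ψₛ) flips ⟨
        ρcyc (ψₛ (ρ Fin.zero))                  ∎
        where open ≡-Reasoning

module MatrixAlgebra {c ℓ} (ℛ : Ring c ℓ) (n : ℕ) where
  open Ring ℛ hiding (zero)
  open Matrices ℛ n
  open import Data.Fin using (_≟_)
  open import Data.Fin.Properties using (suc-injective)
  open import Data.Fin.Permutation using (Permutation′; _⟨$⟩ʳ_; _⟨$⟩ˡ_; inverseˡ; inverseʳ)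
  open import Algebra.Properties.Semiring.Sum semiring using (sum; ∑-distrib-+; ∑-comm; sum-permute)
  open import Relation.Binary.Reasoning.Setoid setoid

  sumI≈sum : ∀ {m} (f : Fin m → Carrier) → sumI f ≈ sum f
  sumI≈sum {zero}  f = refl
  sumI≈sum {suc m} f = +-congˡ (sumI≈sum (f ∘ Fin.suc))

  sumI-cong : ∀ {m} {f g : Fin m → Carrier} → (∀ k → f k ≈ g k) → sumI f ≈ sumI g
  sumI-cong {zero}  f≈g = refl
  sumI-cong {suc m} f≈g = +-cong (f≈g Fin.zero) (sumI-cong (f≈g ∘ Fin.suc))

  sumI-zero : ∀ {m} {f : Fin m → Carrier} → (∀ k → f k ≈ 0#) → sumI f ≈ 0#
  sumI-zero {zero}  f≈0 = refl
  sumI-zero {suc m} f≈0 = trans (+-cong (f≈0 Fin.zero) (sumI-zero (f≈0 ∘ Fin.suc))) (+-identityˡ 0#)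

  sumI-single : ∀ {m} (f : Fin m → Carrier) i → (∀ k → k ≢ i → f k ≈ 0#) → sumI f ≈ f i
  sumI-single {suc m} f Fin.zero f≈0 =
    trans (+-congˡ (sumI-zero (λ k → f≈0 (Fin.suc k) λ ()))) (+-identityʳ _)
  sumI-single {suc m} f (Fin.suc i) f≈0 =
    trans (+-congʳ (f≈0 Fin.zero λ ()))
      (trans (+-identityˡ _) (sumI-single (f ∘ Fin.suc) i λ k k≢i → f≈0 (Fin.suc k) (k≢i ∘ suc-injective)))

  sumI-*ˡ : ∀ {m} x (f : Fin m → Carrier) → x * sumI f ≈ sumI (λ k → x * f k)
  sumI-*ˡ {zero}  x f = zeroʳ x
  sumI-*ˡ {suc m} x f = trans (distribˡ x _ _) (+-congˡ (sumI-*ˡ x (f ∘ Fin.suc)))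

  sumI-*ʳ : ∀ {m} x (f : Fin m → Carrier) → sumI f * x ≈ sumI (λ k → f k * x)
  sumI-*ʳ {zero}  x f = zeroˡ x
  sumI-*ʳ {suc m} x f = trans (distribʳ x _ _) (+-congˡ (sumI-*ʳ x (f ∘ Fin.suc)))

  sumI-+ : ∀ {m} (f g : Fin m → Carrier) → sumI (λ k → f k + g k) ≈ sumI f + sumI g
  sumI-+ f g = begin
    sumI (λ k → f k + g k)  ≈⟨ sumI≈sum (λ k → f k + g k) ⟩
    sum (λ k → f k + g k)   ≈⟨ ∑-distrib-+ f g ⟩
    sum f + sum g           ≈⟨ +-cong (sumI≈sum f) (sumI≈sum g) ⟨
    sumI f + sumI g         ∎

  sumI-comm : ∀ {m p} (f : Fin m → Fin p → Carrier) →
              sumI (λ k → sumI (f k)) ≈ sumI (λ l → sumI (λ k → f k l))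
  sumI-comm f = begin
    sumI (λ k → sumI (f k))                ≈⟨ sumI-cong (λ k → sumI≈sum (f k)) ⟩
    sumI (λ k → sum (f k))                 ≈⟨ sumI≈sum (λ k → sum (f k)) ⟩
    sum (λ k → sum (f k))                  ≈⟨ ∑-comm f ⟩
    sum (λ l → sum (λ k → f k l))          ≈⟨ sumI≈sum (λ l → sum (λ k → f k l)) ⟨
    sumI (λ l → sum (λ k → f k l))         ≈⟨ sumI-cong (λ l → sumI≈sum (λ k → f k l)) ⟨
    sumI (λ l → sumI (λ k → f k l))        ∎

  sumI-permute : ∀ {m} (f : Fin m → Carrier) (π : Permutation′ m) → sumI (λ k → f (π ⟨$⟩ʳ k)) ≈ sumI f
  sumI-permute f π = begin
    sumI (λ k → f (π ⟨$⟩ʳ k))  ≈⟨ sumI≈sum (λ k → f (π ⟨$⟩ʳ k)) ⟩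
    sum (λ k → f (π ⟨$⟩ʳ k))   ≈⟨ sum-permute f π ⟨
    sum f                      ≈⟨ sumI≈sum f ⟨
    sumI f                     ∎

  ≋-refl : ∀ {A} → A ≋ A
  ≋-refl i j = refl

  ≋-sym : ∀ {A B} → A ≋ B → B ≋ A
  ≋-sym A≋B i j = sym (A≋B i j)

  ≋-trans : ∀ {A B C} → A ≋ B → B ≋ C → A ≋ C
  ≋-trans A≋B B≋C i j = trans (A≋B i j) (B≋C i j)

  ⊗-cong : ∀ {A A′ B B′} → A ≋ A′ → B ≋ B′ → (A ⊗ B) ≋ (A′ ⊗ B′)
  ⊗-cong A≋A′ B≋B′ i j = sumI-cong (λ k → *-cong (A≋A′ i k) (B≋B′ k j))

  ⊗-assoc : ∀ A B C → ((A ⊗ B) ⊗ C) ≋ (A ⊗ (B ⊗ C))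
  ⊗-assoc A B C i j = begin
    sumI (λ k → sumI (λ l → A i l * B l k) * C k j)
      ≈⟨ sumI-cong (λ k → sumI-*ʳ (C k j) (λ l → A i l * B l k)) ⟩
    sumI (λ k → sumI (λ l → (A i l * B l k) * C k j))
      ≈⟨ sumI-comm (λ k l → (A i l * B l k) * C k j) ⟩
    sumI (λ l → sumI (λ k → (A i l * B l k) * C k j))
      ≈⟨ sumI-cong (λ l → sumI-cong (λ k → *-assoc (A i l) (B l k) (C k j))) ⟩
    sumI (λ l → sumI (λ k → A i l * (B l k * C k j)))
      ≈⟨ sumI-cong (λ l → sumI-*ˡ (A i l) (λ k → B l k * C k j)) ⟨
    sumI (λ l → A i l * sumI (λ k → B l k * C k j))
      ∎

  δ-refl : ∀ i → δ i i ≡ 1#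
  δ-refl i with i ≟ i
  ... | yes _   = ≡.refl
  ... | no  i≢i = ⊥-elim (i≢i ≡.refl)

  δ-≢ : ∀ {i j} → i ≢ j → δ i j ≡ 0#
  δ-≢ {i} {j} i≢j with i ≟ j
  ... | yes i≡j = ⊥-elim (i≢j i≡j)
  ... | no  _   = ≡.refl

  ⊗-identityˡ : ∀ A → (𝟙 ⊗ A) ≋ A
  ⊗-identityˡ A i j =
    trans (sumI-single (λ k → δ i k * A k j) i
            (λ k k≢i → trans (*-congʳ (reflexive (δ-≢ (k≢i ∘ ≡.sym)))) (zeroˡ _)))
          (trans (*-congʳ (reflexive (δ-refl i))) (*-identityˡ _))

  ⊗-identityʳ : ∀ A → (A ⊗ 𝟙) ≋ A
  ⊗-identityʳ A i j =
    trans (sumI-single (λ k → A i k * δ k j) j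
            (λ k k≢j → trans (*-congˡ (reflexive (δ-≢ k≢j))) (zeroʳ _)))
          (trans (*-congˡ (reflexive (δ-refl j))) (*-identityʳ _))

  inverse-unique : ∀ {A B C} → (B ⊗ A) ≋ 𝟙 → (A ⊗ C) ≋ 𝟙 → B ≋ C
  inverse-unique {A} {B} {C} BA≋𝟙 AC≋𝟙 =
    ≋-trans (≋-sym (⊗-identityʳ B))
      (≋-trans (⊗-cong (≋-refl {B}) (≋-sym AC≋𝟙))
        (≋-trans (≋-sym (⊗-assoc B A C))
          (≋-trans (⊗-cong BA≋𝟙 (≋-refl {C})) (⊗-identityˡ C))))

  cancel-middle : ∀ X A B Y → (A ⊗ B) ≋ 𝟙 → ((X ⊗ A) ⊗ (B ⊗ Y)) ≋ (X ⊗ Y)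
  cancel-middle X A B Y AB≋𝟙 =
    ≋-trans (⊗-assoc X A (B ⊗ Y))
      (⊗-cong (≋-refl {X})
        (≋-trans (≋-sym (⊗-assoc A B Y)) (≋-trans (⊗-cong AB≋𝟙 (≋-refl {Y})) (⊗-identityˡ Y))))

  mask : I → I → Carrier → Carrier
  mask p q v with p ≟ q
  ... | yes _ = v
  ... | no  _ = 0#

  mask-refl : ∀ p v → mask p p v ≡ v
  mask-refl p v with p ≟ p
  ... | yes _   = ≡.refl
  ... | no  p≢p = ⊥-elim (p≢p ≡.refl)

  mask-≢ : ∀ {p q} v → p ≢ q → mask p q v ≡ 0#
  mask-≢ {p} {q} v p≢q with p ≟ q
  ... | yes p≡q = ⊥-elim (p≢q p≡q)
  ... | no  _   = ≡.refl

  mask-cong : ∀ p q {u v} → u ≈ v → mask p q u ≈ mask p q v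
  mask-cong p q u≈v with p ≟ q
  ... | yes _ = u≈v
  ... | no  _ = refl

  mask-+ : ∀ p q u v → mask p q (u + v) ≈ mask p q u + mask p q v
  mask-+ p q u v with p ≟ q
  ... | yes _ = refl
  ... | no  _ = sym (+-identityˡ 0#)

  mask-0 : ∀ p q → mask p q 0# ≈ 0#
  mask-0 p q with p ≟ q
  ... | yes _ = refl
  ... | no  _ = refl

  mask-*ˡ : ∀ p q x v → x * mask p q v ≈ mask p q (x * v)
  mask-*ˡ p q x v with p ≟ q
  ... | yes _ = refl
  ... | no  _ = zeroʳ x

  mask-*ʳ : ∀ p q x v → mask p q v * x ≈ mask p q (v * x)
  mask-*ʳ p q x v with p ≟ q
  ... | yes _ = refl
  ... | no  _ = zeroˡ x

  *-δ : ∀ x b j → x * δ b j ≈ mask j b x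
  *-δ x b j with b ≟ j | j ≟ b
  ... | yes _   | yes _   = *-identityʳ x
  ... | no  _   | no  _   = zeroʳ x
  ... | yes b≡j | no  j≢b = ⊥-elim (j≢b (≡.sym b≡j))
  ... | no  b≢j | yes j≡b = ⊥-elim (b≢j (≡.sym j≡b))

  sumI-mask : ∀ b (f : I → Carrier) → sumI (λ k → mask k b (f k)) ≈ f b
  sumI-mask b f = trans (sumI-single (λ k → mask k b (f k)) b (λ k k≢b → reflexive (mask-≢ _ k≢b)))
                        (reflexive (mask-refl b (f b)))

  sumI-mask-out : ∀ p q (f : I → Carrier) → sumI (λ k → mask p q (f k)) ≈ mask p q (sumI f)
  sumI-mask-out p q f with p ≟ q
  ... | yes _ = refl
  ... | no  _ = sumI-zero {suc n} (λ k → refl)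

  e-normal-form : ∀ {a b} x i j → a ≢ b → e a b x i j ≈ δ i j + mask i a (mask j b x)
  e-normal-form {a} {b} x i j a≢b with i ≟ j
  e-normal-form {a} {b} x i j a≢b | yes ≡.refl with i ≟ a
  ... | no  _      = sym (+-identityʳ 1#)
  ... | yes ≡.refl = sym (trans (+-congˡ (reflexive (mask-≢ x a≢b))) (+-identityʳ 1#))
  e-normal-form {a} {b} x i j a≢b | no _ with i ≟ a | j ≟ b
  ... | yes _ | yes _ = sym (+-identityˡ x)
  ... | yes _ | no  _ = sym (+-identityˡ 0#)
  ... | no  _ | yes _ = sym (+-identityˡ 0#)
  ... | no  _ | no  _ = sym (+-identityˡ 0#)

  e-diagonal : ∀ a b x i → e a b x i i ≡ 1#
  e-diagonal a b x i with i ≟ i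
  ... | yes _   = ≡.refl
  ... | no  i≢i = ⊥-elim (i≢i ≡.refl)

  e-entry : ∀ {a b} x → a ≢ b → e a b x a b ≡ x
  e-entry {a} {b} x a≢b with a ≟ b
  ... | yes a≡b = ⊥-elim (a≢b a≡b)
  ... | no  _ with a ≟ a | b ≟ b
  ...   | yes _   | yes _   = ≡.refl
  ...   | no  a≢a | _       = ⊥-elim (a≢a ≡.refl)
  ...   | yes _   | no  b≢b = ⊥-elim (b≢b ≡.refl)

  e-elsewhere : ∀ {a b} x i k → i ≢ k → ¬ (i ≡ a × k ≡ b) → e a b x i k ≡ 0#
  e-elsewhere {a} {b} x i k i≢k not-ab with i ≟ k
  ... | yes i≡k = ⊥-elim (i≢k i≡k)
  ... | no  _ with i ≟ a | k ≟ b
  ...   | yes i≡a | yes k≡b = ⊥-elim (not-ab (i≡a , k≡b))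
  ...   | yes _   | no  _   = ≡.refl
  ...   | no  _   | yes _   = ≡.refl
  ...   | no  _   | no  _   = ≡.refl

  e-row-source : ∀ {a b} x j → a ≢ b → e a b x a j ≈ δ a j + mask j b x
  e-row-source {a} x j a≢b = trans (e-normal-form x a j a≢b) (+-congˡ (reflexive (mask-refl a _)))

  e-row-other : ∀ {a b} x i j → a ≢ b → i ≢ a → e a b x i j ≈ δ i j
  e-row-other x i j a≢b i≢a =
    trans (e-normal-form x i j a≢b) (trans (+-congˡ (reflexive (mask-≢ _ i≢a))) (+-identityʳ _))

  e-⊗ : ∀ {a b} x M i j → a ≢ b → (e a b x ⊗ M) i j ≈ M i j + mask i a (x * M b j)
  e-⊗ {a} {b} x M i j a≢b = begin
    sumI (λ k → e a b x i k * M k j)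
      ≈⟨ sumI-cong (λ k → trans (*-congʳ (e-normal-form x i k a≢b)) (distribʳ (M k j) _ _)) ⟩
    sumI (λ k → δ i k * M k j + mask i a (mask k b x) * M k j)
      ≈⟨ sumI-+ (λ k → δ i k * M k j) (λ k → mask i a (mask k b x) * M k j) ⟩
    (𝟙 ⊗ M) i j + sumI (λ k → mask i a (mask k b x) * M k j)
      ≈⟨ +-cong (⊗-identityˡ M i j)
                (sumI-cong (λ k → trans (mask-*ʳ i a (M k j) _) (mask-cong i a (mask-*ʳ k b (M k j) x)))) ⟩
    M i j + sumI (λ k → mask i a (mask k b (x * M k j)))
      ≈⟨ +-congˡ (trans (sumI-mask-out i a (λ k → mask k b (x * M k j))) (mask-cong i a (sumI-mask b (λ k → x * M k j)))) ⟩
    M i j + mask i a (x * M b j)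
      ∎

  e-cong : ∀ {a b x y} → x ≈ y → e a b x ≋ e a b y
  e-cong {a} {b} x≈y k l with k ≟ l
  ... | yes _ = refl
  ... | no  _ with k ≟ a | l ≟ b
  ...   | yes _ | yes _ = x≈y
  ...   | yes _ | no  _ = refl
  ...   | no  _ | yes _ = refl
  ...   | no  _ | no  _ = refl

  e-0 : ∀ {a b} → a ≢ b → e a b 0# ≋ 𝟙
  e-0 {a} {b} a≢b i j =
    trans (e-normal-form 0# i j a≢b) (trans (+-congˡ (trans (mask-cong i a (mask-0 j b)) (mask-0 i a))) (+-identityʳ _))

  e-+ : ∀ {a b} x y → a ≢ b → (e a b x ⊗ e a b y) ≋ e a b (x + y)
  e-+ {a} {b} x y a≢b i j = begin
    (e a b x ⊗ e a b y) i j
      ≈⟨ e-⊗ x (e a b y) i j a≢b ⟩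
    e a b y i j + mask i a (x * e a b y b j)
      ≈⟨ +-cong (e-normal-form y i j a≢b) (mask-cong i a x·row-b) ⟩
    (δ i j + mask i a (mask j b y)) + mask i a (mask j b x)
      ≈⟨ +-assoc _ _ _ ⟩
    δ i j + (mask i a (mask j b y) + mask i a (mask j b x))
      ≈⟨ +-congˡ (+-comm _ _) ⟩
    δ i j + (mask i a (mask j b x) + mask i a (mask j b y))
      ≈⟨ +-congˡ (trans (mask-cong i a (mask-+ j b x y)) (mask-+ i a _ _)) ⟨
    δ i j + mask i a (mask j b (x + y))
      ≈⟨ e-normal-form (x + y) i j a≢b ⟨
    e a b (x + y) i j
      ∎
    where
      x·row-b : x * e a b y b j ≈ mask j b x
      x·row-b = trans (*-congˡ (e-row-other y b j a≢b (a≢b ∘ ≡.sym))) (*-δ x b j)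

  e-inverseʳ : ∀ {a b} x → a ≢ b → (e a b x ⊗ e a b (- x)) ≋ 𝟙
  e-inverseʳ x a≢b = ≋-trans (e-+ x (- x) a≢b) (≋-trans (e-cong (-‿inverseʳ x)) (e-0 a≢b))

  e-inverseˡ : ∀ {a b} x → a ≢ b → (e a b (- x) ⊗ e a b x) ≋ 𝟙
  e-inverseˡ x a≢b = ≋-trans (e-+ (- x) x a≢b) (≋-trans (e-cong (-‿inverseˡ x)) (e-0 a≢b))

  -- The commutator relation [e_{a,b}(x), e_{b,d}(y)] = e_{a,d}(xy), stated without inverses.
  e-commutator : ∀ {a b d} x y → a ≢ b → b ≢ d → a ≢ d →
                 (e a d (x * y) ⊗ (e b d y ⊗ e a b x)) ≋ (e a b x ⊗ e b d y)
  e-commutator {a} {b} {d} x y a≢b b≢d a≢d i j = begin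
    (e a d (x * y) ⊗ W) i j
      ≈⟨ e-⊗ (x * y) W i j a≢d ⟩
    W i j + mask i a ((x * y) * W d j)
      ≈⟨ +-cong W-entry (mask-cong i a (trans (*-congˡ W-row-d) (*-δ (x * y) d j))) ⟩
    ((δ i j + mask i a (mask j b x)) + mask i b (mask j d y)) + mask i a (mask j d (x * y))
      ≈⟨ rearrange (δ i j) (mask i b (mask j d y)) (mask i a (mask j b x)) (mask i a (mask j d (x * y))) ⟨
    (δ i j + mask i b (mask j d y)) + (mask i a (mask j b x) + mask i a (mask j d (x * y)))
      ≈⟨ +-cong (e-normal-form y i j b≢d) (trans (mask-cong i a x·row-b) (mask-+ i a _ _)) ⟨
    e b d y i j + mask i a (x * e b d y b j)
      ≈⟨ e-⊗ x (e b d y) i j a≢b ⟨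
    (e a b x ⊗ e b d y) i j
      ∎
    where
      W = e b d y ⊗ e a b x
      e-ab-row-d : ∀ j → e a b x d j ≈ δ d j
      e-ab-row-d j = e-row-other x d j a≢b (a≢d ∘ ≡.sym)
      W-entry : W i j ≈ (δ i j + mask i a (mask j b x)) + mask i b (mask j d y)
      W-entry = trans (e-⊗ y (e a b x) i j b≢d)
                  (+-cong (e-normal-form x i j a≢b)
                          (mask-cong i b (trans (*-congˡ (e-ab-row-d j)) (*-δ y d j))))
      W-row-d : W d j ≈ δ d j
      W-row-d = trans (e-⊗ y (e a b x) d j b≢d)
                  (trans (+-cong (e-ab-row-d j) (reflexive (mask-≢ _ (b≢d ∘ ≡.sym)))) (+-identityʳ _))
      x·row-b : x * e b d y b j ≈ mask j b x + mask j d (x * y)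
      x·row-b = trans (*-congˡ (e-row-source y j b≢d)) (trans (distribˡ x _ _) (+-cong (*-δ x b j) (mask-*ˡ j d x y)))
      rearrange : ∀ u v w z → (u + v) + (w + z) ≈ ((u + w) + v) + z
      rearrange u v w z = begin
        (u + v) + (w + z)  ≈⟨ +-assoc (u + v) w z ⟨
        ((u + v) + w) + z  ≈⟨ +-congʳ (trans (+-assoc u v w) (trans (+-congˡ (+-comm v w)) (sym (+-assoc u w v)))) ⟩
        ((u + w) + v) + z  ∎

  module _ (π : Permutation′ (suc n)) where

    γ : Mat → Mat
    γ A u v = A (π ⟨$⟩ˡ u) (π ⟨$⟩ˡ v)

    γ-graph : ∀ A → Graphγ (π ⟨$⟩ʳ_) A (γ A)
    γ-graph A i j = reflexive (≡.cong₂ A (inverseˡ π) (inverseˡ π))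

    graph⇒≋γ : ∀ {A B} → Graphγ (π ⟨$⟩ʳ_) A B → B ≋ γ A
    graph⇒≋γ {A} {B} graph u v =
      trans (reflexive (≡.sym (≡.cong₂ B (inverseʳ π) (inverseʳ π)))) (graph (π ⟨$⟩ˡ u) (π ⟨$⟩ˡ v))

    γ-cong : ∀ {A B} → A ≋ B → γ A ≋ γ B
    γ-cong A≋B u v = A≋B _ _

    permute-injective : ∀ {i j} → π ⟨$⟩ʳ i ≡ π ⟨$⟩ʳ j → i ≡ j
    permute-injective {i} {j} eq = ≡.trans (≡.sym (inverseˡ π)) (≡.trans (≡.cong (π ⟨$⟩ˡ_) eq) (inverseˡ π))

    δ-permute : ∀ i j → δ (π ⟨$⟩ˡ i) (π ⟨$⟩ˡ j) ≡ δ i j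
    δ-permute i j with i ≟ j
    ... | yes ≡.refl = δ-refl (π ⟨$⟩ˡ i)
    ... | no  i≢j    = δ-≢ (λ eq → i≢j (≡.trans (≡.sym (inverseʳ π)) (≡.trans (≡.cong (π ⟨$⟩ʳ_) eq) (inverseʳ π))))

    γ-𝟙 : γ 𝟙 ≋ 𝟙
    γ-𝟙 u v = reflexive (δ-permute u v)

    γ-⊗ : ∀ A B → γ (A ⊗ B) ≋ (γ A ⊗ γ B)
    γ-⊗ A B u v = sym (sumI-permute (λ k → A (π ⟨$⟩ˡ u) k * B k (π ⟨$⟩ˡ v)) (Data.Fin.Permutation.flip π))

    mask-permute : ∀ p q v → mask (π ⟨$⟩ʳ p) (π ⟨$⟩ʳ q) v ≡ mask p q v
    mask-permute p q v with p ≟ q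
    ... | yes ≡.refl = mask-refl (π ⟨$⟩ʳ p) v
    ... | no  p≢q    = mask-≢ v (p≢q ∘ permute-injective)

    γ-e : ∀ {a b} x → a ≢ b → γ (e a b x) ≋ e (π ⟨$⟩ʳ a) (π ⟨$⟩ʳ b) x
    γ-e {a} {b} x a≢b u v = begin
      e a b x u′ v′                                       ≈⟨ e-normal-form x u′ v′ a≢b ⟩
      δ u′ v′ + mask u′ a (mask v′ b x)                    ≈⟨ +-cong (reflexive (δ-permute u v)) (sym mask-eq) ⟩
      δ u v + mask u (π ⟨$⟩ʳ a) (mask v (π ⟨$⟩ʳ b) x)     ≈⟨ e-normal-form x u v (a≢b ∘ permute-injective) ⟨
      e (π ⟨$⟩ʳ a) (π ⟨$⟩ʳ b) x u v                       ∎
      where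
        u′ = π ⟨$⟩ˡ u
        v′ = π ⟨$⟩ˡ v
        mask-eq : mask u (π ⟨$⟩ʳ a) (mask v (π ⟨$⟩ʳ b) x) ≈ mask u′ a (mask v′ b x)
        mask-eq = begin
          mask u (π ⟨$⟩ʳ a) (mask v (π ⟨$⟩ʳ b) x)
            ≡⟨ ≡.cong₂ (λ p q → mask p (π ⟨$⟩ʳ a) (mask q (π ⟨$⟩ʳ b) x)) (inverseʳ π {u}) (inverseʳ π {v}) ⟨
          mask (π ⟨$⟩ʳ u′) (π ⟨$⟩ʳ a) (mask (π ⟨$⟩ʳ v′) (π ⟨$⟩ʳ b) x)
            ≡⟨ ≡.cong (mask (π ⟨$⟩ʳ u′) (π ⟨$⟩ʳ a)) (mask-permute v′ b x) ⟩
          mask (π ⟨$⟩ʳ u′) (π ⟨$⟩ʳ a) (mask v′ b x)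
            ≡⟨ mask-permute u′ a (mask v′ b x) ⟩
          mask u′ a (mask v′ b x)
            ∎

  γ-inverse : ∀ π {A B} → (A ⊗ B) ≋ 𝟙 → (γ π A ⊗ γ π B) ≋ 𝟙
  γ-inverse π {A} {B} AB≋𝟙 = ≋-trans (≋-sym (γ-⊗ π A B)) (≋-trans (γ-cong π AB≋𝟙) (γ-𝟙 π))

  -- θ A = γ_{ρrev}(A)ᵗ, so that γ_s(A) = θ(A)⁻¹.
  θ : Mat → Mat
  θ A a b = A (ρrev b) (ρrev a)

  Invertible : ∀ {p} → Pred p → Mat → Set (c ⊔ ℓ ⊔ p)
  Invertible P A = Σ Mat λ A′ → P A′ × (A ⊗ A′) ≋ 𝟙 × (A′ ⊗ A) ≋ 𝟙

  record IsSubmonoid {p} (P : Pred p) : Set (c ⊔ ℓ ⊔ p) where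
    field
      ≋-closed : ∀ {A B} → P A → A ≋ B → P B
      𝟙-closed : P 𝟙
      ⊗-closed : ∀ {A B} → P A → P B → P (A ⊗ B)

  -- Carrying an inverse inside P is what handles the constructor inv, whose new element is the inverse of an old one.
  ⟨⟩⊆invertible : ∀ {p q} {S : Pred p} {P : Pred q} → IsSubmonoid P →
                  (∀ {A} → S A → P A × Invertible P A) → ∀ {A} → ⟨ S ⟩ A → P A × Invertible P A
  ⟨⟩⊆invertible P-sub gens (gen g) = gens g
  ⟨⟩⊆invertible P-sub gens one = 𝟙-closed , 𝟙 , 𝟙-closed , ⊗-identityˡ 𝟙 , ⊗-identityˡ 𝟙
    where open IsSubmonoid P-sub
  ⟨⟩⊆invertible P-sub gens (mul {A} {B} a b)
    with ⟨⟩⊆invertible P-sub gens a | ⟨⟩⊆invertible P-sub gens b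
  ... | PA , A′ , PA′ , AA′ , A′A | PB , B′ , PB′ , BB′ , B′B =
    ⊗-closed PA PB , (B′ ⊗ A′) , ⊗-closed PB′ PA′ ,
    ≋-trans (cancel-middle A B B′ A′ BB′) AA′ , ≋-trans (cancel-middle B′ A′ A B A′A) B′B
    where open IsSubmonoid P-sub
  ⟨⟩⊆invertible P-sub gens (inv {A} {B} a AB BA) with ⟨⟩⊆invertible P-sub gens a
  ... | PA , A′ , PA′ , AA′ , A′A =
    ≋-closed PA′ (≋-sym (inverse-unique {A} {B} {A′} BA AA′)) , A , PA , BA , AB
    where open IsSubmonoid P-sub
  ⟨⟩⊆invertible P-sub gens (resp {A} {B} a A≋B) with ⟨⟩⊆invertible P-sub gens a
  ... | PA , A′ , PA′ , AA′ , A′A =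
    ≋-closed PA A≋B , A′ , PA′ ,
    ≋-trans (⊗-cong (≋-sym A≋B) (≋-refl {A′})) AA′ , ≋-trans (⊗-cong (≋-refl {A′}) (≋-sym A≋B)) A′A
    where open IsSubmonoid P-sub

  ⟨⟩-isSubmonoid : ∀ {p} {S : Pred p} → IsSubmonoid ⟨ S ⟩
  ⟨⟩-isSubmonoid = record { ≋-closed = resp ; 𝟙-closed = one ; ⊗-closed = mul }

  ⟨⟩-invertible : ∀ {p} {S : Pred p} → (∀ {A} → S A → Σ Mat λ A′ → (A ⊗ A′) ≋ 𝟙 × (A′ ⊗ A) ≋ 𝟙) →
                  ∀ {A} → ⟨ S ⟩ A → Invertible ⟨ S ⟩ A
  ⟨⟩-invertible units =
    proj₂ ∘ ⟨⟩⊆invertible ⟨⟩-isSubmonoid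
      (λ g → let (A′ , AA′ , A′A) = units g in gen g , A′ , inv (gen g) AA′ A′A , AA′ , A′A)

  ⟨⟩-cancelʳ : ∀ {p} {S : Pred p} → (∀ {A} → ⟨ S ⟩ A → Invertible ⟨ S ⟩ A) →
               ∀ {Z W X} → ⟨ S ⟩ W → ⟨ S ⟩ X → (Z ⊗ W) ≋ X → ⟨ S ⟩ Z
  ⟨⟩-cancelʳ invertible {Z} {W} {X} w x ZW≋X with invertible w
  ... | W′ , w′ , WW′ , _ =
    resp (mul x w′)
      (≋-trans (⊗-cong (≋-sym ZW≋X) (≋-refl {W′}))
        (≋-trans (⊗-assoc Z W W′) (≋-trans (⊗-cong (≋-refl {Z}) WW′) (⊗-identityʳ Z))))

  record IsEndomorphism (f : Mat → Mat) : Set (c ⊔ ℓ) where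
    field
      cong : ∀ {A B} → A ≋ B → f A ≋ f B
      𝟙-homo : f 𝟙 ≋ 𝟙
      ⊗-homo : ∀ A B → f (A ⊗ B) ≋ (f A ⊗ f B)

  ⟨⟩-map : ∀ {p q} {S : Pred p} {S′ : Pred q} {f : Mat → Mat} → IsEndomorphism f →
           (∀ {A} → S A → ⟨ S′ ⟩ (f A)) → ∀ {A} → ⟨ S ⟩ A → ⟨ S′ ⟩ (f A)
  ⟨⟩-map f-endo gens (gen g) = gens g
  ⟨⟩-map f-endo gens one = resp one (≋-sym 𝟙-homo)
    where open IsEndomorphism f-endo
  ⟨⟩-map f-endo gens (mul {A} {B} a b) =
    resp (mul (⟨⟩-map f-endo gens a) (⟨⟩-map f-endo gens b)) (≋-sym (⊗-homo A B))
    where open IsEndomorphism f-endo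
  ⟨⟩-map {f = f} f-endo gens (inv {A} {B} a AB BA) =
    inv (⟨⟩-map f-endo gens a) (preserves-unit A B AB) (preserves-unit B A BA)
    where
      open IsEndomorphism f-endo
      preserves-unit : ∀ X Y → (X ⊗ Y) ≋ 𝟙 → (f X ⊗ f Y) ≋ 𝟙
      preserves-unit X Y XY = ≋-trans (≋-sym (⊗-homo X Y)) (≋-trans (cong XY) 𝟙-homo)
  ⟨⟩-map f-endo gens (resp a A≋B) = resp (⟨⟩-map f-endo gens a) (cong A≋B)
    where open IsEndomorphism f-endo

  γ-isEndomorphism : ∀ π → IsEndomorphism (γ π)
  γ-isEndomorphism π = record { cong = γ-cong π ; 𝟙-homo = γ-𝟙 π ; ⊗-homo = γ-⊗ π }

module Parabolic {c ℓ q} (ℛ : Ring c ℓ) (n : ℕ) (1≤n : 1 ≤ n) (T : Ring.Carrier ℛ → Set q) where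
  open Ring ℛ hiding (zero)
  open Matrices ℛ n
  open MatrixAlgebra ℛ n
  open CyclicIndex n using (ρcyc-≢)
  open import Data.Fin.Permutation using (Permutation′; _⟨$⟩ʳ_)

  ≢ρcyc : ∀ j → j ≢ ρcyc j
  ≢ρcyc j = ρcyc-≢ 1≤n j ∘ ≡.sym

  K-invertible : ∀ {i A} → K T i A → Invertible (K T i) A
  K-invertible = ⟨⟩-invertible λ { {A} (j , m , _ , _ , A≋e) →
    e j (ρcyc j) (- m) ,
    ≋-trans (⊗-cong A≋e (≋-refl {e j (ρcyc j) (- m)})) (e-inverseʳ m (≢ρcyc j)) ,
    ≋-trans (⊗-cong (≋-refl {e j (ρcyc j) (- m)}) A≋e) (e-inverseˡ m (≢ρcyc j)) }

  K-γ : (π : Permutation′ (suc n)) → (∀ j → π ⟨$⟩ʳ ρcyc j ≡ ρcyc (π ⟨$⟩ʳ j)) →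
        ∀ {i A} → K T i A → K T (π ⟨$⟩ʳ i) (γ π A)
  K-γ π comm = ⟨⟩-map (γ-isEndomorphism π) λ { {A} (j , m , j≢i , m∈T , A≋e) →
    gen (π ⟨$⟩ʳ j , m , j≢i ∘ permute-injective π , m∈T ,
         ≋-trans (γ-cong π A≋e) (≋-trans (γ-e π m (≢ρcyc j)) (e-target (comm j)))) }
    where
      e-target : ∀ {a b b′ x} → b ≡ b′ → e a b x ≋ e a b′ x
      e-target ≡.refl = ≋-refl

  module _ where
    open import Data.Nat as ℕ using (_<_; _∸_)
    import Data.Nat.Properties as ℕₚ
    open ℕₚ using (<-cmp; <-irrefl; <⇒≤; ≤-trans; m≤m+n; m<m+n; m+[n∸m]≡n; m∸n+n≡m; +-∸-assoc)
    open import Relation.Binary using (tri<; tri≈; tri>)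
    open import Data.Fin.Properties using (toℕ-injective)
    open import Data.Fin using (_≟_)
    open CyclicIndex n using (last; ⟦_⟧; toℕ-⟦⟧-≤; toℕ≤n; ρcyc-of-suc; suc-≢last; toℕ-ρcyc-<; ≢last⇒<; toℕ-ρrev)

    Klast : Pred (c ⊔ ℓ ⊔ q)
    Klast = K T last

    Admissible : ℕ → Carrier → Set (c ⊔ ℓ ⊔ q)
    Admissible k x = ∀ a b → a ≢ b → toℕ b ≡ toℕ a ℕ.+ k → Klast (e a b x)

    Admissible-≈ : ∀ {k x y} → x ≈ y → Admissible k x → Admissible k y
    Admissible-≈ x≈y adm a b a≢b gap = resp (adm a b a≢b gap) (e-cong x≈y)

    Admissible-0 : ∀ {k} → Admissible k 0#
    Admissible-0 a b a≢b _ = resp one (≋-sym (e-0 a≢b))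

    Admissible-+ : ∀ {k x y} → Admissible k x → Admissible k y → Admissible k (x + y)
    Admissible-+ adm-x adm-y a b a≢b gap = resp (mul (adm-x a b a≢b gap) (adm-y a b a≢b gap)) (e-+ _ _ a≢b)

    Admissible-sumI : ∀ {k m} (f : Fin m → Carrier) → (∀ i → Admissible k (f i)) → Admissible k (sumI f)
    Admissible-sumI {m = zero}  f adm = Admissible-0
    Admissible-sumI {m = suc m} f adm = Admissible-+ (adm Fin.zero) (Admissible-sumI (f ∘ Fin.suc) (adm ∘ Fin.suc))

    Admissible-neg : ∀ {k x} → Admissible k x → Admissible k (- x)
    Admissible-neg {x = x} adm a b a≢b gap = inv (adm a b a≢b gap) (e-inverseʳ x a≢b) (e-inverseˡ x a≢b)

    T⇒Admissible : ∀ {m} → T m → Admissible 1 m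
    T⇒Admissible {m} m∈T a b a≢b gap =
      gen (a , m , suc-≢last gap′ , m∈T , ≡.subst (λ b′ → e a b m ≋ e a b′ m) (ρcyc-of-suc gap′) ≋-refl)
      where gap′ = ≡.trans gap (ℕₚ.+-comm (toℕ a) 1)

    -- e_{a,d}(xy) is the commutator of e_{a,b}(x) and e_{b,d}(y) for the intermediate index b = a + j.
    Admissible-* : ∀ {j l x y} → 1 ≤ j → 1 ≤ l → Admissible j x → Admissible l y → Admissible (j ℕ.+ l) (x * y)
    Admissible-* {j} {l} {x} {y} 1≤j 1≤l adm-x adm-y a d a≢d gap =
      ⟨⟩-cancelʳ K-invertible (mul e-bd e-ab) (mul e-ab e-bd) (e-commutator x y a≢b b≢d a≢d)
      where
        b : I
        b = ⟦ toℕ a ℕ.+ j ⟧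
        gap-ad : toℕ d ≡ (toℕ a ℕ.+ j) ℕ.+ l
        gap-ad = ≡.trans gap (≡.sym (ℕₚ.+-assoc (toℕ a) j l))
        gap-ab : toℕ b ≡ toℕ a ℕ.+ j
        gap-ab = toℕ-⟦⟧-≤ (≤-trans (m≤m+n _ l) (≡.subst (_≤ n) gap-ad (toℕ≤n d)))
        gap-bd : toℕ d ≡ toℕ b ℕ.+ l
        gap-bd = ≡.trans gap-ad (≡.cong (ℕ._+ l) (≡.sym gap-ab))
        a≢b : a ≢ b
        a≢b a≡b = <-irrefl (≡.trans (≡.cong toℕ a≡b) gap-ab) (m<m+n (toℕ a) 1≤j)
        b≢d : b ≢ d
        b≢d b≡d = <-irrefl (≡.trans (≡.cong toℕ b≡d) gap-bd) (m<m+n (toℕ b) 1≤l)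
        e-ab = adm-x a b a≢b gap-ab
        e-bd = adm-y b d b≢d gap-bd

    ∸-split : ∀ {a k b} → a ≤ k → k ≤ b → (k ∸ a) ℕ.+ (b ∸ k) ≡ b ∸ a
    ∸-split {a} {k} {b} a≤k k≤b = ≡.trans (ℕₚ.+-comm (k ∸ a) (b ∸ k))
      (≡.sym (≡.trans (≡.cong (_∸ a) (≡.sym (m∸n+n≡m k≤b))) (+-∸-assoc (b ∸ k) a≤k)))

    toℕ<⇒≢ : ∀ {a b : I} → toℕ a < toℕ b → a ≢ b
    toℕ<⇒≢ lt a≡b = <-irrefl (≡.cong toℕ a≡b) lt

    toℕ>⇒≢ : ∀ {a b : I} → toℕ b < toℕ a → a ≢ b
    toℕ>⇒≢ lt a≡b = <-irrefl (≡.cong toℕ (≡.sym a≡b)) lt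

    record AdmissibleUnitriangular (A : Mat) : Set (c ⊔ ℓ ⊔ q) where
      field
        diagonal : ∀ a → A a a ≈ 1#
        below    : ∀ a b → toℕ b < toℕ a → A a b ≈ 0#
        above    : ∀ a b → toℕ a < toℕ b → Admissible (toℕ b ∸ toℕ a) (A a b)
    open AdmissibleUnitriangular

    entry-Admissible : ∀ {a b x} → toℕ a < toℕ b → Admissible (toℕ b ∸ toℕ a) x → Klast (e a b x)
    entry-Admissible {a} {b} lt adm = adm a b (toℕ<⇒≢ lt) (≡.sym (m+[n∸m]≡n (<⇒≤ lt)))

    AU-≋ : ∀ {A B} → AdmissibleUnitriangular A → A ≋ B → AdmissibleUnitriangular B
    AU-≋ au A≋B = record
      { diagonal = λ a → trans (sym (A≋B a a)) (diagonal au a)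
      ; below    = λ a b lt → trans (sym (A≋B a b)) (below au a b lt)
      ; above    = λ a b lt → Admissible-≈ (A≋B a b) (above au a b lt)
      }

    AU-𝟙 : AdmissibleUnitriangular 𝟙
    AU-𝟙 = record
      { diagonal = λ a → reflexive (δ-refl a)
      ; below    = λ a b lt → reflexive (δ-≢ (toℕ>⇒≢ lt))
      ; above    = λ a b lt → Admissible-≈ (sym (reflexive (δ-≢ (toℕ<⇒≢ lt)))) Admissible-0
      }

    AU-e : ∀ {j x} → j ≢ last → Admissible 1 x → AdmissibleUnitriangular (e j (ρcyc j) x)
    AU-e {j} {x} j≢last adm = record
      { diagonal = λ a → reflexive (e-diagonal j (ρcyc j) x a)
      ; below    = λ a b b<a → reflexive (e-elsewhere x a b (toℕ>⇒≢ b<a) (not-below b<a))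
      ; above    = above′
      }
      where
        gap : toℕ (ρcyc j) ≡ ℕ.suc (toℕ j)
        gap = toℕ-ρcyc-< j (≢last⇒< j≢last)
        not-below : ∀ {a b} → toℕ b < toℕ a → ¬ (a ≡ j × b ≡ ρcyc j)
        not-below b<a (≡.refl , ≡.refl) = ℕₚ.<-asym b<a (≡.subst (toℕ j <_) (≡.sym gap) (ℕₚ.n<1+n (toℕ j)))
        above′ : ∀ a b → toℕ a < toℕ b → Admissible (toℕ b ∸ toℕ a) (e j (ρcyc j) x a b)
        above′ a b a<b with a ≟ j | b ≟ ρcyc j
        ... | yes ≡.refl | yes ≡.refl =
          Admissible-≈ (sym (reflexive (e-entry x (≢ρcyc j))))
            (≡.subst (λ k → Admissible k x) (≡.sym (≡.trans (≡.cong (_∸ toℕ j) gap) (ℕₚ.m+n∸n≡m 1 (toℕ j)))) adm)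
        ... | no a≢j | _ =
          Admissible-≈ (sym (reflexive (e-elsewhere x a b (toℕ<⇒≢ a<b) (a≢j ∘ proj₁)))) Admissible-0
        ... | yes _ | no b≢ρcyc-j =
          Admissible-≈ (sym (reflexive (e-elsewhere x a b (toℕ<⇒≢ a<b) (b≢ρcyc-j ∘ proj₂)))) Admissible-0

    AU-⊗ : ∀ {A B} → AdmissibleUnitriangular A → AdmissibleUnitriangular B → AdmissibleUnitriangular (A ⊗ B)
    AU-⊗ {A} {B} au bu = record { diagonal = diagonal′ ; below = below′ ; above = above′ }
      where
        diagonal′ : ∀ a → (A ⊗ B) a a ≈ 1#
        diagonal′ a = trans (sumI-single (λ k → A a k * B k a) a vanish)
                            (trans (*-cong (diagonal au a) (diagonal bu a)) (*-identityˡ 1#))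
          where
            vanish : ∀ k → k ≢ a → A a k * B k a ≈ 0#
            vanish k k≢a with <-cmp (toℕ k) (toℕ a)
            ... | tri< k<a _ _ = trans (*-congʳ (below au a k k<a)) (zeroˡ _)
            ... | tri≈ _ k≡a _ = ⊥-elim (k≢a (toℕ-injective k≡a))
            ... | tri> _ _ a<k = trans (*-congˡ (below bu k a a<k)) (zeroʳ _)
        below′ : ∀ a b → toℕ b < toℕ a → (A ⊗ B) a b ≈ 0#
        below′ a b b<a = sumI-zero vanish
          where
            vanish : ∀ k → A a k * B k b ≈ 0#
            vanish k with <-cmp (toℕ k) (toℕ a)
            ... | tri< k<a _ _ = trans (*-congʳ (below au a k k<a)) (zeroˡ _)
            ... | tri≈ _ k≡a _ = trans (*-congˡ (below bu k b (≡.subst (toℕ b <_) (≡.sym k≡a) b<a))) (zeroʳ _)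
            ... | tri> _ _ a<k = trans (*-congˡ (below bu k b (ℕₚ.<-trans b<a a<k))) (zeroʳ _)
        above′ : ∀ a b → toℕ a < toℕ b → Admissible (toℕ b ∸ toℕ a) ((A ⊗ B) a b)
        above′ a b a<b = Admissible-sumI (λ k → A a k * B k b) term
          where
            term : ∀ k → Admissible (toℕ b ∸ toℕ a) (A a k * B k b)
            term k with <-cmp (toℕ k) (toℕ a) | <-cmp (toℕ k) (toℕ b)
            ... | tri< k<a _ _ | _ =
              Admissible-≈ (sym (trans (*-congʳ (below au a k k<a)) (zeroˡ _))) Admissible-0
            ... | tri≈ _ k≡a _ | _ with toℕ-injective k≡a
            ...   | ≡.refl = Admissible-≈ (sym (trans (*-congʳ (diagonal au k)) (*-identityˡ _))) (above bu k b a<b)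
            term k | tri> _ _ a<k | tri< k<b _ _ =
              ≡.subst (λ d → Admissible d (A a k * B k b)) (∸-split (<⇒≤ a<k) (<⇒≤ k<b))
                (Admissible-* (ℕₚ.m<n⇒0<n∸m a<k) (ℕₚ.m<n⇒0<n∸m k<b) (above au a k a<k) (above bu k b k<b))
            term k | tri> _ _ a<k | tri≈ _ k≡b _ with toℕ-injective k≡b
            ...   | ≡.refl = Admissible-≈ (sym (trans (*-congˡ (diagonal bu k)) (*-identityʳ _))) (above au a k a<b)
            term k | tri> _ _ a<k | tri> _ _ b<k =
              Admissible-≈ (sym (trans (*-congˡ (below bu k b b<k)) (zeroʳ _))) Admissible-0

    AU-θ : ∀ {A} → AdmissibleUnitriangular A → AdmissibleUnitriangular (θ A)
    AU-θ {A} au = record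
      { diagonal = λ a → diagonal au (ρrev a)
      ; below    = λ a b b<a → below au (ρrev b) (ρrev a) (ρrev-< b<a)
      ; above    = λ a b a<b → ≡.subst (λ d → Admissible d (A (ρrev b) (ρrev a))) (distance-ρrev a<b)
                                 (above au (ρrev b) (ρrev a) (ρrev-< a<b))
      }
      where
        ρrev-< : ∀ {a b} → toℕ a < toℕ b → toℕ (ρrev b) < toℕ (ρrev a)
        ρrev-< {a} {b} a<b =
          ≡.subst₂ _<_ (≡.sym (toℕ-ρrev b)) (≡.sym (toℕ-ρrev a)) (ℕₚ.∸-monoʳ-< a<b (toℕ≤n b))
        distance-ρrev : ∀ {a b} → toℕ a < toℕ b → toℕ (ρrev a) ∸ toℕ (ρrev b) ≡ toℕ b ∸ toℕ a
        distance-ρrev {a} {b} a<b = begin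
          toℕ (ρrev a) ∸ toℕ (ρrev b)              ≡⟨ ≡.cong₂ _∸_ (toℕ-ρrev a) (toℕ-ρrev b) ⟩
          (n ∸ toℕ a) ∸ (n ∸ toℕ b)                ≡⟨ ≡.cong (_∸ (n ∸ toℕ b)) (∸-split (<⇒≤ a<b) (toℕ≤n b)) ⟨
          ((toℕ b ∸ toℕ a) ℕ.+ (n ∸ toℕ b)) ∸ (n ∸ toℕ b) ≡⟨ ℕₚ.m+n∸n≡m (toℕ b ∸ toℕ a) (n ∸ toℕ b) ⟩
          toℕ b ∸ toℕ a                            ∎
          where open ≡.≡-Reasoning

    AU-isSubmonoid : IsSubmonoid AdmissibleUnitriangular
    AU-isSubmonoid = record { ≋-closed = AU-≋ ; 𝟙-closed = AU-𝟙 ; ⊗-closed = AU-⊗ }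

    Klast⊆AU : ∀ {A} → Klast A → AdmissibleUnitriangular A
    Klast⊆AU = proj₁ ∘ ⟨⟩⊆invertible AU-isSubmonoid λ { {A} (j , m , j≢last , m∈T , A≋e) →
      AU-≋ (AU-e j≢last (T⇒Admissible m∈T)) (≋-sym A≋e) ,
      e j (ρcyc j) (- m) , AU-e j≢last (Admissible-neg (T⇒Admissible m∈T)) ,
      ≋-trans (⊗-cong A≋e (≋-refl {e j (ρcyc j) (- m)})) (e-inverseʳ m (≢ρcyc j)) ,
      ≋-trans (⊗-cong (≋-refl {e j (ρcyc j) (- m)}) A≋e) (e-inverseˡ m (≢ρcyc j)) }

    -- X is rebuilt entry by entry in row-major order; at each step the row of the new column is still that of 𝟙,
    -- so left multiplication by an admissible elementary matrix writes exactly one entry.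
    module Filling (X : Mat) (au : AdmissibleUnitriangular X) where
      open import Relation.Nullary.Decidable using (_×-dec_; _⊎-dec_)

      Filled : ℕ → ℕ → I → I → Set
      Filled a c i j = toℕ i < toℕ j × (toℕ i < a ⊎ (toℕ i ≡ a × toℕ j < c))

      filled? : ∀ a c i j → Dec (Filled a c i j)
      filled? a c i j = (toℕ i ℕₚ.<? toℕ j) ×-dec ((toℕ i ℕₚ.<? a) ⊎-dec ((toℕ i ℕₚ.≟ a) ×-dec (toℕ j ℕₚ.<? c)))

      partial : ℕ → ℕ → Mat
      partial a c i j with filled? a c i j
      ... | yes _ = X i j
      ... | no  _ = δ i j

      partial-filled : ∀ {a c} i j → Filled a c i j → partial a c i j ≡ X i j
      partial-filled {a} {c} i j filled with filled? a c i j
      ... | yes _        = ≡.refl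
      ... | no  unfilled = ⊥-elim (unfilled filled)

      partial-unfilled : ∀ {a c} i j → ¬ Filled a c i j → partial a c i j ≡ δ i j
      partial-unfilled {a} {c} i j unfilled with filled? a c i j
      ... | yes filled = ⊥-elim (unfilled filled)
      ... | no  _      = ≡.refl

      partial-ext : ∀ {a c a′ c′} i j → (Filled a c i j → Filled a′ c′ i j) → (Filled a′ c′ i j → Filled a c i j) →
                    partial a c i j ≈ partial a′ c′ i j
      partial-ext {a} {c} {a′} {c′} i j to from with filled? a c i j
      ... | yes filled   = reflexive (≡.sym (partial-filled i j (to filled)))
      ... | no  unfilled = reflexive (≡.sym (partial-unfilled i j (unfilled ∘ from)))

      partial-start : partial 0 0 ≋ 𝟙
      partial-start i j = reflexive (partial-unfilled i j λ { (_ , inj₁ ()) ; (_ , inj₂ (_ , ())) })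

      partial-end : partial (ℕ.suc n) 0 ≋ X
      partial-end i j with <-cmp (toℕ i) (toℕ j)
      ... | tri< i<j _ _ = reflexive (partial-filled i j (i<j , inj₁ (s≤s (toℕ≤n i))))
      ... | tri≈ i≮j i≡j _ with toℕ-injective i≡j
      ...   | ≡.refl = trans (reflexive (≡.trans (partial-unfilled i j (i≮j ∘ proj₁)) (δ-refl i))) (sym (diagonal au i))
      partial-end i j | tri> i≮j _ j<i =
        trans (reflexive (≡.trans (partial-unfilled i j (i≮j ∘ proj₁)) (δ-≢ (toℕ>⇒≢ j<i)))) (sym (below au i j j<i))

      partial-next-row : ∀ a → partial a (ℕ.suc n) ≋ partial (ℕ.suc a) 0
      partial-next-row a i j = partial-ext i j to from
        where
          to : Filled a (ℕ.suc n) i j → Filled (ℕ.suc a) 0 i j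
          to (i<j , inj₁ i<a)       = i<j , inj₁ (ℕₚ.m<n⇒m<1+n i<a)
          to (i<j , inj₂ (i≡a , _)) = i<j , inj₁ (s≤s (ℕₚ.≤-reflexive i≡a))
          from : Filled (ℕ.suc a) 0 i j → Filled a (ℕ.suc n) i j
          from (i<j , inj₁ i<1+a) with ℕₚ.m≤n⇒m<n∨m≡n (ℕ.s≤s⁻¹ i<1+a)
          ... | inj₁ i<a = i<j , inj₁ i<a
          ... | inj₂ i≡a = i<j , inj₂ (i≡a , s≤s (toℕ≤n j))

      partial-skip : ∀ {a c} → c ≤ a → partial a (ℕ.suc c) ≋ partial a c
      partial-skip {a} {c} c≤a i j = partial-ext i j to from
        where
          to : Filled a (ℕ.suc c) i j → Filled a c i j
          to (i<j , inj₁ i<a) = i<j , inj₁ i<a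
          to (i<j , inj₂ (i≡a , j<1+c)) with ℕₚ.m≤n⇒m<n∨m≡n (ℕ.s≤s⁻¹ j<1+c)
          ... | inj₁ j<c = i<j , inj₂ (i≡a , j<c)
          ... | inj₂ j≡c = ⊥-elim (<-irrefl ≡.refl (ℕₚ.<-≤-trans i<j (≡.subst₂ _≤_ (≡.sym j≡c) (≡.sym i≡a) c≤a)))
          from : Filled a c i j → Filled a (ℕ.suc c) i j
          from (i<j , inj₁ i<a)         = i<j , inj₁ i<a
          from (i<j , inj₂ (i≡a , j<c)) = i<j , inj₂ (i≡a , ℕₚ.m<n⇒m<1+n j<c)

      partial-step : ∀ {a c} → a < c → c ≤ n →
                     partial a (ℕ.suc c) ≋ (e ⟦ a ⟧ ⟦ c ⟧ (X ⟦ a ⟧ ⟦ c ⟧) ⊗ partial a c)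
      partial-step {a} {c} a<c c≤n i j = begin
        partial a (ℕ.suc c) i j                             ≈⟨ new-entry (i ≟ A) (j ≟ C) ⟩
        partial a c i j + mask i A (mask j C x)             ≈⟨ +-congˡ (mask-cong i A x·row-C) ⟨
        partial a c i j + mask i A (x * partial a c C j)    ≈⟨ e-⊗ x (partial a c) i j A≢C ⟨
        (e A C x ⊗ partial a c) i j                         ∎
        where
          open import Relation.Binary.Reasoning.Setoid setoid
          A = ⟦ a ⟧
          C = ⟦ c ⟧
          x = X A C
          toℕ-C : toℕ C ≡ c
          toℕ-C = toℕ-⟦⟧-≤ c≤n
          toℕ-A : toℕ A ≡ a
          toℕ-A = toℕ-⟦⟧-≤ (≤-trans (<⇒≤ a<c) c≤n)
          A≢C : A ≢ C
          A≢C A≡C = <-irrefl (≡.trans (≡.sym toℕ-A) (≡.trans (≡.cong toℕ A≡C) toℕ-C)) a<c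
          x·row-C : x * partial a c C j ≈ mask j C x
          x·row-C = trans (*-congˡ (reflexive (partial-unfilled C j row-C-unfilled))) (*-δ x C j)
            where
              row-C-unfilled : ¬ Filled a c C j
              row-C-unfilled (_ , inj₁ c<a)       = ℕₚ.<-asym a<c (≡.subst (_< a) toℕ-C c<a)
              row-C-unfilled (_ , inj₂ (c≡a , _)) = <-irrefl (≡.trans (≡.sym c≡a) toℕ-C) a<c
          earlier : Filled a c i j → Filled a (ℕ.suc c) i j
          earlier (i<j , inj₁ i<a)         = i<j , inj₁ i<a
          earlier (i<j , inj₂ (i≡a , j<c)) = i<j , inj₂ (i≡a , ℕₚ.m<n⇒m<1+n j<c)
          unchanged : ∀ {i j} → (i ≢ A ⊎ j ≢ C) → Filled a (ℕ.suc c) i j → Filled a c i j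
          unchanged _ (i<j , inj₁ i<a) = i<j , inj₁ i<a
          unchanged {i} {j} i≢A⊎j≢C (i<j , inj₂ (i≡a , j<1+c)) with ℕₚ.m≤n⇒m<n∨m≡n (ℕ.s≤s⁻¹ j<1+c)
          ... | inj₁ j<c = i<j , inj₂ (i≡a , j<c)
          ... | inj₂ j≡c with i≢A⊎j≢C
          ...   | inj₁ i≢A = ⊥-elim (i≢A (toℕ-injective (≡.trans i≡a (≡.sym toℕ-A))))
          ...   | inj₂ j≢C = ⊥-elim (j≢C (toℕ-injective (≡.trans j≡c (≡.sym toℕ-C))))
          new-entry : Dec (i ≡ A) → Dec (j ≡ C) → partial a (ℕ.suc c) i j ≈ partial a c i j + mask i A (mask j C x)
          new-entry (yes ≡.refl) (yes ≡.refl) = begin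
            partial a (ℕ.suc c) A C      ≈⟨ reflexive (partial-filled A C now-filled) ⟩
            x                            ≈⟨ +-identityˡ x ⟨
            0# + x                       ≈⟨ +-cong (reflexive (≡.trans (partial-unfilled A C not-yet) (δ-≢ A≢C)))
                                                   (reflexive (≡.trans (mask-refl A _) (mask-refl C x))) ⟨
            partial a c A C + mask A A (mask C C x) ∎
            where
              now-filled : Filled a (ℕ.suc c) A C
              now-filled = ≡.subst₂ _<_ (≡.sym toℕ-A) (≡.sym toℕ-C) a<c
                         , inj₂ (toℕ-A , ≡.subst (_< ℕ.suc c) (≡.sym toℕ-C) (ℕₚ.n<1+n c))
              not-yet : ¬ Filled a c A C
              not-yet (_ , inj₁ a<a)       = <-irrefl toℕ-A a<a
              not-yet (_ , inj₂ (_ , c<c)) = <-irrefl toℕ-C c<c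
          new-entry (yes i≡A) (no j≢C) =
            trans (partial-ext i j (unchanged (inj₂ j≢C)) earlier)
                  (sym (trans (+-congˡ (trans (mask-cong i A (reflexive (mask-≢ x j≢C))) (mask-0 i A))) (+-identityʳ _)))
          new-entry (no i≢A) _ =
            trans (partial-ext i j (unchanged (inj₁ i≢A)) earlier)
                  (sym (trans (+-congˡ (reflexive (mask-≢ _ i≢A))) (+-identityʳ _)))

      partial-row : ∀ a → Klast (partial a 0) → ∀ c → c ≤ ℕ.suc n → Klast (partial a c)
      partial-row a start zero    _       = start
      partial-row a start (ℕ.suc c) 1+c≤1+n with ℕₚ.≤-<-connex c a
      ... | inj₁ c≤a = resp previous (≋-sym (partial-skip c≤a))
        where previous = partial-row a start c (ℕₚ.m≤n⇒m≤1+n (ℕ.s≤s⁻¹ 1+c≤1+n))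
      ... | inj₂ a<c = resp (mul new-entry previous) (≋-sym (partial-step a<c c≤n))
        where
          c≤n = ℕ.s≤s⁻¹ 1+c≤1+n
          previous = partial-row a start c (ℕₚ.m≤n⇒m≤1+n c≤n)
          toℕ-A = toℕ-⟦⟧-≤ (≤-trans (<⇒≤ a<c) c≤n)
          toℕ-C = toℕ-⟦⟧-≤ c≤n
          A<C : toℕ ⟦ a ⟧ < toℕ ⟦ c ⟧
          A<C = ≡.subst₂ _<_ (≡.sym toℕ-A) (≡.sym toℕ-C) a<c
          new-entry = entry-Admissible A<C (above au ⟦ a ⟧ ⟦ c ⟧ A<C)

      partial-rows : ∀ a → a ≤ ℕ.suc n → Klast (partial a 0)
      partial-rows zero      _         = resp one (≋-sym partial-start)
      partial-rows (ℕ.suc a) 1+a≤1+n =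
        resp (partial-row a (partial-rows a (ℕₚ.m≤n⇒m≤1+n (ℕ.s≤s⁻¹ 1+a≤1+n))) (ℕ.suc n) ℕₚ.≤-refl)
             (partial-next-row a)

      X∈Klast : Klast X
      X∈Klast = resp (partial-rows (ℕ.suc n) ℕₚ.≤-refl) partial-end

    AU⊆Klast : ∀ {X} → AdmissibleUnitriangular X → Klast X
    AU⊆Klast {X} au = Filling.X∈Klast X au

    Klast-θ : ∀ {A} → Klast A → Klast (θ A)
    Klast-θ = AU⊆Klast ∘ AU-θ ∘ Klast⊆AU

  open CyclicIndex n using (ρcyc⁻¹; ψₛ; last; ρcyc^; ρcyc-perm; ρcyc⁻¹-perm; ρrev-perm; ρcyc-last; ρcyc^-zero;
                            ρcyc-ρcyc⁻¹; ρcyc⁻¹-ρcyc; ρcyc⁻¹-ρcyc-comm; ψₛ-last; ψₛ-ρcyc; ρrev-ρcyc; ρrev-involutive)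

  K-ρcyc : ∀ {i A} → K T i A → K T (ρcyc i) (γ ρcyc-perm A)
  K-ρcyc = K-γ ρcyc-perm (λ _ → ≡.refl)

  K-ρcyc⁻¹ : ∀ {i A} → K T i A → K T (ρcyc⁻¹ i) (γ ρcyc⁻¹-perm A)
  K-ρcyc⁻¹ = K-γ ρcyc⁻¹-perm ρcyc⁻¹-ρcyc-comm

  θ-conjugate : ∀ A → θ A ≋ γ ρcyc⁻¹-perm (θ (γ ρcyc⁻¹-perm A))
  θ-conjugate A u v = reflexive (≡.cong₂ A (ρcyc-ρrev-ρcyc v) (ρcyc-ρrev-ρcyc u))
    where
      ρcyc-ρrev-ρcyc : ∀ x → ρrev x ≡ ρcyc (ρrev (ρcyc x))
      ρcyc-ρrev-ρcyc x = ≡.sym (≡.trans (≡.cong ρcyc (ρrev-ρcyc x)) (ρcyc-ρcyc⁻¹ (ρrev x)))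

  -- On K_last, θ is handled by the description of K_last; conjugating by ρcyc transports this to every K_i.
  K-θ : ∀ i {A} → K T i A → K T (ψₛ i) (θ A)
  K-θ i = ≡.subst ThetaAt (ρcyc^-zero i) (along (toℕ i))
    where
      ThetaAt : I → Set (c ⊔ ℓ ⊔ q)
      ThetaAt j = ∀ {A} → K T j A → K T (ψₛ j) (θ A)
      step : ∀ j → ThetaAt j → ThetaAt (ρcyc j)
      step j θ-at-j {A} a =
        ≡.subst (λ k → K T k (θ A)) (≡.sym (ψₛ-ρcyc j))
          (resp (K-ρcyc⁻¹ (θ-at-j rotated-back)) (≋-sym (θ-conjugate A)))
        where
          rotated-back : K T j (γ ρcyc⁻¹-perm A)
          rotated-back = ≡.subst (λ k → K T k (γ ρcyc⁻¹-perm A)) (ρcyc⁻¹-ρcyc j) (K-ρcyc⁻¹ a)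
      along : ∀ k → ThetaAt (ρcyc^ k Fin.zero)
      along zero    = ≡.subst ThetaAt ρcyc-last (step last θ-at-last)
        where
          θ-at-last : ThetaAt last
          θ-at-last {A} = ≡.subst (λ k → K T k (θ A)) (≡.sym ψₛ-last) ∘ Klast-θ
      along (suc k) = step _ (along k)

  K-r : ∀ {i A B} → K T i A → Graphr A B → K T (ρcyc i) B
  K-r a graph = resp (K-ρcyc a) (≋-sym (graph⇒≋γ ρcyc-perm graph))

  K-r⁻¹ : ∀ {i A B} → K T i A → Graphr B A → K T (ρcyc⁻¹ i) B
  K-r⁻¹ a graph = resp (K-ρcyc⁻¹ a) graph

  K-s : ∀ {i A B} → K T i A → Graphs A B → K T (ψₛ i) B
  K-s {i} {A} {B} a (C , C-graph , _ , BᵗC) with K-invertible a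
  ... | A′ , a′ , AA′ , _ = resp (K-θ i a′) θA′≋B
    where
      C-γA′ : (C ⊗ γ ρrev-perm A′) ≋ 𝟙
      C-γA′ = ≋-trans (⊗-cong (graph⇒≋γ ρrev-perm {A} {C} C-graph) (≋-refl {γ ρrev-perm A′}))
                      (γ-inverse ρrev-perm {A} {A′} AA′)
      θA′≋B : θ A′ ≋ B
      θA′≋B u v = sym (inverse-unique {C} {transpose B} {γ ρrev-perm A′} BᵗC C-γA′ v u)

  K-s⁻¹ : ∀ {i A B} → K T i A → Graphs B A → K T (ψₛ i) B
  K-s⁻¹ {i} {A} {B} a (C , C-graph , CAᵗ , AᵗC) =
    inv (K-θ i a)
        (≋-trans (⊗-cong (≋-refl {θ A}) B≋γC) (γ-inverse ρrev-perm {transpose A} {C} AᵗC))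
        (≋-trans (⊗-cong B≋γC (≋-refl {θ A})) (γ-inverse ρrev-perm {C} {transpose A} CAᵗ))
    where
      B≋γC : B ≋ γ ρrev-perm C
      B≋γC u v = sym (C-graph u v)

  r-defined : ∀ A → Σ Mat λ B → Graphr A B
  r-defined A = γ ρcyc-perm A , γ-graph ρcyc-perm A

  r⁻¹-defined : ∀ A → Σ Mat λ B → Graphr B A
  r⁻¹-defined A = γ ρcyc⁻¹-perm A , λ u v → refl

  s-defined : ∀ {i A} → K T i A → Σ Mat λ B → Graphs A B
  s-defined {A = A} a with K-invertible a
  ... | A′ , _ , AA′ , A′A =
    θ A′ , γ ρrev-perm A , γ-graph ρrev-perm A ,
    γ-inverse ρrev-perm {A} {A′} AA′ , γ-inverse ρrev-perm {A′} {A} A′A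

  s⁻¹-defined : ∀ {i A} → K T i A → Σ Mat λ B → Graphs B A
  s⁻¹-defined {i} {A} a with K-invertible (K-θ i a)
  ... | Y , _ , θAY , YθA =
    Y , γ ρrev-perm Y , γ-graph ρrev-perm Y ,
    ≋-trans (⊗-cong (≋-refl {γ ρrev-perm Y}) Aᵗ≋γθA) (γ-inverse ρrev-perm {Y} {θ A} YθA) ,
    ≋-trans (⊗-cong Aᵗ≋γθA (≋-refl {γ ρrev-perm Y})) (γ-inverse ρrev-perm {θ A} {Y} θAY)
    where
      Aᵗ≋γθA : transpose A ≋ γ ρrev-perm (θ A)
      Aᵗ≋γθA u v = reflexive (≡.sym (≡.cong₂ A (ρrev-involutive v) (ρrev-involutive u)))

module Words {c ℓ q} (ℛ : Ring c ℓ) (n : ℕ) (1≤n : 1 ≤ n) (T : Ring.Carrier ℛ → Set q) where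
  open Matrices ℛ n
  open MatrixAlgebra ℛ n using (≋-refl)
  open Parabolic ℛ n 1≤n T
  open CyclicIndex n using (ρcyc⁻¹; ψₛ; ρcyc^; ρcyc-ρcyc⁻¹; ρcyc⁻¹-ρcyc; ψₛ-involutive)
  open Dihedral n using (id-InDihedral; ∘-InDihedral; ρcyc-InDihedral; ρcyc⁻¹-InDihedral; ψₛ-InDihedral)
  open import Level using (lift)
  open import Data.List using ([]; _∷_; replicate)

  ψ-letter : Letter → I → I
  ψ-letter r   = ρcyc
  ψ-letter r⁻¹ = ρcyc⁻¹
  ψ-letter s   = ψₛ
  ψ-letter s⁻¹ = ψₛ

  ψ-word : Γ → I → I
  ψ-word []      i = i
  ψ-word (g ∷ w) i = ψ-letter g (ψ-word w i)

  letter⁻¹ : Letter → Letter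
  letter⁻¹ r   = r⁻¹
  letter⁻¹ r⁻¹ = r
  letter⁻¹ s   = s⁻¹
  letter⁻¹ s⁻¹ = s

  GraphL-letter⁻¹ : ∀ g {A B} → GraphL (letter⁻¹ g) B A → GraphL g A B
  GraphL-letter⁻¹ r   graph = graph
  GraphL-letter⁻¹ r⁻¹ graph = graph
  GraphL-letter⁻¹ s   graph = graph
  GraphL-letter⁻¹ s⁻¹ graph = graph

  ψ-letter⁻¹ : ∀ g i → ψ-letter (letter⁻¹ g) (ψ-letter g i) ≡ i
  ψ-letter⁻¹ r   = ρcyc⁻¹-ρcyc
  ψ-letter⁻¹ r⁻¹ = ρcyc-ρcyc⁻¹
  ψ-letter⁻¹ s   = ψₛ-involutive
  ψ-letter⁻¹ s⁻¹ = ψₛ-involutive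

  K-letter : ∀ g {i A B} → K T i A → GraphL g A B → K T (ψ-letter g i) B
  K-letter r   a (lift graph) = K-r a graph
  K-letter r⁻¹ a (lift graph) = K-r⁻¹ a graph
  K-letter s   a graph        = K-s a graph
  K-letter s⁻¹ a graph        = K-s⁻¹ a graph

  letter-defined : ∀ g {i A} → K T i A → Σ Mat (GraphL g A)
  letter-defined r   {A = A} _ = proj₁ (r-defined A) , lift (proj₂ (r-defined A))
  letter-defined r⁻¹ {A = A} _ = proj₁ (r⁻¹-defined A) , lift (proj₂ (r⁻¹-defined A))
  letter-defined s   a         = s-defined a
  letter-defined s⁻¹ a         = s⁻¹-defined a

  K-word : ∀ w {i A B} → K T i A → Graph w A B → K T (ψ-word w i) B
  K-word []      a (lift A≋B)              = resp a A≋B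
  K-word (g ∷ w) a (_ , graph-w , graph-g) = K-letter g (K-word w a graph-w) graph-g

  -- Each letter has an inverse letter, so a preimage is found by running the word backwards.
  K-word-preimage : ∀ w {i B} → K T (ψ-word w i) B → Σ Mat λ A → K T i A × Graph w A B
  K-word-preimage []      {B = B} b = B , b , lift (≋-refl {B})
  K-word-preimage (g ∷ w) {i}     b with letter-defined (letter⁻¹ g) b
  ... | C , graph-g⁻¹ with K-word-preimage w {i}
        (≡.subst (λ j → K T j C) (ψ-letter⁻¹ g (ψ-word w i)) (K-letter (letter⁻¹ g) b graph-g⁻¹))
  ...   | A , a , graph-w = A , a , C , graph-w , GraphL-letter⁻¹ g graph-g⁻¹

  image-K : ∀ w i → image w (K T i) ≐ K T (ψ-word w i)
  image-K w i B = (λ { (A , a , graph) → K-word w a graph }) , K-word-preimage w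

  ψ-letter-InDihedral : ∀ g → InDihedral (ψ-letter g)
  ψ-letter-InDihedral r   = ρcyc-InDihedral 1≤n
  ψ-letter-InDihedral r⁻¹ = ρcyc⁻¹-InDihedral 1≤n
  ψ-letter-InDihedral s   = ψₛ-InDihedral 1≤n
  ψ-letter-InDihedral s⁻¹ = ψₛ-InDihedral 1≤n

  ψ-word-InDihedral : ∀ w → InDihedral (ψ-word w)
  ψ-word-InDihedral []      = id-InDihedral
  ψ-word-InDihedral (g ∷ w) = ∘-InDihedral (ψ-letter-InDihedral g) (ψ-word-InDihedral w)

  ψ-word-rᵐ : ∀ m i → ψ-word (replicate m r) i ≡ ρcyc^ m i
  ψ-word-rᵐ zero    i = ≡.refl
  ψ-word-rᵐ (suc m) i = ≡.cong ρcyc (ψ-word-rᵐ m i)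

  image-K-≡ : ∀ w {i j} → ψ-word w i ≡ j → image w (K T i) ≐ K T j
  image-K-≡ w {i} ≡.refl = image-K w i

  dihedral-realised : 2 ≤ n → ∀ ρ → InDihedral ρ → Σ Γ λ w → ∀ i → ψ-word w i ≡ ρ i
  dihedral-realised 2≤n ρ D with Dihedral.dihedral-classification n 2≤n ρ D
  ... | m , inj₁ rotation   = replicate m r     , λ i → ≡.trans (ψ-word-rᵐ m i) (≡.sym (rotation i))
  ... | m , inj₂ reflection = s ∷ replicate m r , λ i → ≡.trans (≡.cong ψₛ (ψ-word-rᵐ m i)) (≡.sym (reflection i))

theorem3p10 : ∀ {a b c ℓ} (R : CommutativeRing a b) (ℛ : Ring c ℓ)
                (φ : CommutativeRing.Carrier R → Ring.Carrier ℛ) → IsAlgebraMap R ℛ φ →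
                (l : ℕ) (t : Fin l → Ring.Carrier ℛ) → AlgebraDefs.Generates R ℛ φ t →
                (n : ℕ) → 2 ≤ n →
                let open Matrices ℛ n
                    Kᵢ = K (AlgebraDefs.InT R ℛ φ t)
                in
                -- Γ preserves the subgroup geometry system (K_{i})_{i ∈ I}
                (∀ (γ : Γ) →
                    (∀ (i : I) → Σ I λ j → image γ (Kᵢ i) ≐ Kᵢ j)
                  × (∀ (j : I) → Σ I λ i → image γ (Kᵢ i) ≐ Kᵢ j))
                -- Ψ(Γ) ⊆ D_{n+1}
                × (∀ (γ : Γ) → Σ (I → I) λ ψ →
                    (∀ (i : I) → image γ (Kᵢ i) ≐ Kᵢ (ψ i)) × InDihedral ψ)
                -- D_{n+1} ⊆ Ψ(Γ)
                × (∀ (ρ : I → I) → InDihedral ρ → Σ Γ λ γ →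
                    ∀ (i : I) → image γ (Kᵢ i) ≐ Kᵢ (ρ i))
theorem3p10 R ℛ φ _ l t _ n 2≤n =
    (λ w → (λ i → ψ-word w i , image-K w i)
         , (λ j → let (i , ψi≡j) = proj₂ (proj₁ (ψ-word-InDihedral w)) j
                  in i , image-K-≡ w (ψi≡j ≡.refl)))
  , (λ w → ψ-word w , image-K w , ψ-word-InDihedral w)
  , (λ ρ D → let (w , ψ≡ρ) = dihedral-realised 2≤n ρ D
             in w , λ i → image-K-≡ w (ψ≡ρ i))
  where open Words ℛ n (<⇒≤ 2≤n) (AlgebraDefs.InT R ℛ φ t)
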